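{- Let $M=\prod_{i=1}^Kp_i^{n_i}$ and $A\oplus B=\mathbb{Z}_M$. Let $m=\prod_ip_i^{\alpha_i}$ and $m'=\prod_ip_i^{\alpha_i'}$ with $0\le\alpha_i,\alpha_i'\le n_i$. Assume at least one of $m,m'$ is different from $M$, and that for every $i$ either $\alpha_i\ne\alpha_i'$ or $\alpha_i=\alpha_i'=n_i$. Then for all $x,y\in\mathbb{Z}_M$, $$\mathbb{A}_m[x]\,\mathbb{A}_{m'}[x]\,\mathbb{B}_m[y]\,\mathbb{B}_{m'}[y]=0;$$ that is, there are no $(a,a',b,b')\in A\times A\times B\times B$ with $\gcd(a-x,M)=\gcd(b-y,M)=m$ and $\gcd(a'-x,M)=\gcd(b'-y,M)=m'$.
   Context: $p_i$ distinct primes, $n_i\ge1$. $A\oplus B=\mathbb{Z}_M$ means each element of $\mathbb{Z}_M$ is uniquely $a+b$. $\mathbb{A}_m[x]=\#\{a\in A:\gcd(x-a,M)=m\}$, $\mathbb{B}_m[y]=\#\{b\in B:\gcd(y-b,M)=m\}$. -}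

module Defs where

open import Data.Nat using (ℕ; zero; suc; _+_; _*_; _∸_; _^_; _≟_)
open import Data.Nat.GCD using (gcd)
open import Data.Fin using (Fin; toℕ)
open import Data.Fin.Subset using (Subset; _∈_)
open import Data.Fin.Subset.Properties using (_∈?_)
open import Data.List using (List; length; filter)
open import Data.List using () renaming (allFin to allFinL)
open import Data.Sum using (_⊎_)
open import Data.Product using (_×_; _,_; ∃-syntax)
open import Relation.Nullary.Decidable using (_×-dec_)
open import Relation.Binary.PropositionalEquality using (_≡_)

∏ : (K : ℕ) → (Fin K → ℕ) → ℕ
∏ zero    f = 1
∏ (suc K) f = f Fin.zero * ∏ K (λ i → f (Fin.suc i))

primeProd : (K : ℕ) → (Fin K → ℕ) → (Fin K → ℕ) → ℕ
primeProd K p e = ∏ K (λ i → p i ^ e i)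

-- gcd(x - a, M), where x - a is computed in ℤ_M via the representative x + (M - a) ≥ 0
-- (this is ≡ x - a mod M, and gcd(·, M) only depends on the residue mod M)
gcdDiff : (M : ℕ) → Fin M → Fin M → ℕ
gcdDiff M x a = gcd (toℕ x + (M ∸ toℕ a)) M

-- a + b ≡ z in ℤ_M (a, b, z < M, so a + b is z or z + M)
AddMod : (M : ℕ) → Fin M → Fin M → Fin M → Set
AddMod M a b z = (toℕ a + toℕ b ≡ toℕ z) ⊎ (toℕ a + toℕ b ≡ toℕ z + M)

IsTiling : (M : ℕ) → Subset M → Subset M → Set
IsTiling M A B =
  ((z : Fin M) → ∃[ a ] ∃[ b ] (a ∈ A × b ∈ B × AddMod M a b z))
  × ((z a a' b b' : Fin M) → a ∈ A → a' ∈ A → b ∈ B → b' ∈ B →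
       AddMod M a b z → AddMod M a' b' z → (a ≡ a') × (b ≡ b'))

count : (M : ℕ) → Subset M → ℕ → Fin M → ℕ
count M A m x = length (filter (λ a → (a ∈? A) ×-dec (gcdDiff M x a ≟ m)) (allFinL M))

{-# OPTIONS --safe #-}
-- Identify a subset X of ℤ_M with its mask, the function ℤ_M → ℕ counting X, so that convolution ⊛ is the
-- product of the group semiring ℕ[ℤ_M]; A ⊕ B = ℤ_M says that A ⊛ B is constantly 1.  By Tijdeman's theorem
-- the dilation tA ⊕ B is again a tiling whenever t is prime to M.  It suffices to dilate by one prime q ∤ M:
-- by Frobenius qA ⊛ B ≡ A^q ⊛ B = A^(q-1) ⊛ (A ⊛ B) ≡ |A|^(q-1) (mod q) is positive everywhere, and its
-- values sum to |A| |B| = M, so they all equal 1.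
--
-- At a prime p with α ≠ α′ both a′ - a and b′ - b are divisible by exactly p^min(α,α′), while at the other
-- primes both are divisible by p^n; so a Chinese-remainder argument gives t prime to M with
-- t(a′ - a) ≡ b′ - b (mod M).  Then ta + b′ ≡ ta′ + b, and uniqueness of representations in tA ⊕ B forces
-- b = b′, which is impossible since p^(min(α,α′) + 1) ∤ b′ - b at a prime with α ≠ α′.
module Submission where

open import Data.Nat as ℕ using (ℕ; NonZero)
open import Data.Nat.Primality using (Prime)
open import Data.Fin using (Fin)
open import Function.Definitions using (Injective)
open import Relation.Binary.PropositionalEquality using (_≡_; _≢_; refl; sym; trans; cong; subst)

module RangeSum where

  open import Data.Nat
  open import Data.Nat.Properties
  open import Relation.Binary.PropositionalEquality
  open import Relation.Nullary using (yes; no)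
  open import Data.Empty using (⊥-elim)
  open import Function using (_∘_)
  open import Algebra.Properties.CommutativeSemigroup +-commutativeSemigroup using (interchange; xy∙z≈xz∙y)

  ∑< : ℕ → (ℕ → ℕ) → ℕ
  ∑< zero    f = 0
  ∑< (suc n) f = ∑< n f + f n

  ∑<-cong : ∀ n {f g : ℕ → ℕ} → (∀ j → j < n → f j ≡ g j) → ∑< n f ≡ ∑< n g
  ∑<-cong zero    f≗g = refl
  ∑<-cong (suc n) f≗g = cong₂ _+_ (∑<-cong n (λ j j<n → f≗g j (m<n⇒m<1+n j<n))) (f≗g n ≤-refl)

  ∑<-distrib-+ : ∀ n (f g : ℕ → ℕ) → ∑< n (λ j → f j + g j) ≡ ∑< n f + ∑< n g
  ∑<-distrib-+ zero    f g = refl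
  ∑<-distrib-+ (suc n) f g rewrite ∑<-distrib-+ n f g = interchange (∑< n f) (∑< n g) (f n) (g n)

  ∑<-*ˡ : ∀ n c (f : ℕ → ℕ) → ∑< n (λ j → c * f j) ≡ c * ∑< n f
  ∑<-*ˡ zero    c f = sym (*-zeroʳ c)
  ∑<-*ˡ (suc n) c f rewrite ∑<-*ˡ n c f = sym (*-distribˡ-+ c (∑< n f) (f n))

  ∑<-*ʳ : ∀ n c (f : ℕ → ℕ) → ∑< n (λ j → f j * c) ≡ ∑< n f * c
  ∑<-*ʳ n c f = trans (∑<-cong n (λ j _ → *-comm (f j) c)) (trans (∑<-*ˡ n c f) (*-comm c (∑< n f)))

  ∑<-zero : ∀ n → ∑< n (λ _ → 0) ≡ 0
  ∑<-zero zero    = refl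
  ∑<-zero (suc n) rewrite ∑<-zero n = refl

  ∑<-const : ∀ n c → ∑< n (λ _ → c) ≡ n * c
  ∑<-const zero    c = refl
  ∑<-const (suc n) c rewrite ∑<-const n c = +-comm (n * c) c

  ∑<-comm : ∀ n m (f : ℕ → ℕ → ℕ) → ∑< n (λ i → ∑< m (f i)) ≡ ∑< m (λ j → ∑< n (λ i → f i j))
  ∑<-comm zero    m f = sym (∑<-zero m)
  ∑<-comm (suc n) m f rewrite ∑<-comm n m f = sym (∑<-distrib-+ m (λ j → ∑< n (λ i → f i j)) (f n))

  ∑<-suc : ∀ n (f : ℕ → ℕ) → ∑< (suc n) f ≡ f 0 + ∑< n (f ∘ suc)
  ∑<-suc zero    f = +-comm 0 (f 0)
  ∑<-suc (suc n) f rewrite ∑<-suc n f = +-assoc (f 0) (∑< n (f ∘ suc)) (f (suc n))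

  ∑<-ends : ∀ n (f : ℕ → ℕ) → ∑< (suc (suc n)) f ≡ f 0 + f (suc n) + ∑< n (f ∘ suc)
  ∑<-ends n f = trans (cong (_+ f (suc n)) (∑<-suc n f)) (xy∙z≈xz∙y (f 0) (∑< n (f ∘ suc)) (f (suc n)))

  ∑<-reverse : ∀ n (g : ℕ → ℕ) → ∑< n (λ j → g (n ∸ j)) ≡ ∑< n (g ∘ suc)
  ∑<-reverse zero    g = refl
  ∑<-reverse (suc n) g = begin
    ∑< n (λ j → g (suc n ∸ j)) + g (suc n ∸ n) ≡⟨ cong₂ _+_ (∑<-cong n (λ j j<n → cong g (+-∸-assoc 1 (<⇒≤ j<n))))
                                                              (cong g (trans (+-∸-assoc 1 (≤-refl {n})) (cong suc (n∸n≡0 n)))) ⟩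
    ∑< n (λ j → g (suc (n ∸ j))) + g 1          ≡⟨ cong (_+ g 1) (∑<-reverse n (g ∘ suc)) ⟩
    ∑< n (g ∘ suc ∘ suc) + g 1                   ≡⟨ +-comm _ (g 1) ⟩
    g 1 + ∑< n (g ∘ suc ∘ suc)                   ≡⟨ ∑<-suc n (g ∘ suc) ⟨
    ∑< (suc n) (g ∘ suc)                         ∎
    where open ≡-Reasoning

  δ : ℕ → ℕ → ℕ
  δ i j with i ≟ j
  ... | yes _ = 1
  ... | no  _ = 0

  δ-refl : ∀ i → δ i i ≡ 1
  δ-refl i with i ≟ i
  ... | yes _  = refl
  ... | no i≢i = ⊥-elim (i≢i refl)

  δ-≢ : ∀ {i j} → i ≢ j → δ i j ≡ 0
  δ-≢ {i} {j} i≢j with i ≟ j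
  ... | yes i≡j = ⊥-elim (i≢j i≡j)
  ... | no  _   = refl

  δ-sym : ∀ i j → δ i j ≡ δ j i
  δ-sym i j with i ≟ j | j ≟ i
  ... | yes _   | yes _   = refl
  ... | no  _   | no  _   = refl
  ... | yes i≡j | no  j≢i = ⊥-elim (j≢i (sym i≡j))
  ... | no  i≢j | yes j≡i = ⊥-elim (i≢j (sym j≡i))

  δ-cong : ∀ {i j i′ j′} → (i ≡ j → i′ ≡ j′) → (i′ ≡ j′ → i ≡ j) → δ i j ≡ δ i′ j′
  δ-cong {i} {j} {i′} {j′} to from with i ≟ j | i′ ≟ j′
  ... | yes _   | yes _    = refl
  ... | no  _   | no  _    = refl
  ... | yes i≡j | no  i′≢j′ = ⊥-elim (i′≢j′ (to i≡j))
  ... | no  i≢j | yes i′≡j′ = ⊥-elim (i≢j (from i′≡j′))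

  ∑<-single : ∀ n (f : ℕ → ℕ) k → k < n → (∀ j → j < n → j ≢ k → f j ≡ 0) → ∑< n f ≡ f k
  ∑<-single (suc n) f k k<1+n others with k ≟ n
  ... | yes refl = cong (_+ f k) (trans (∑<-cong n (λ j j<k → others j (m<n⇒m<1+n j<k) (<⇒≢ j<k))) (∑<-zero n))
  ... | no  k≢n  = trans (cong₂ _+_ (∑<-single n f k (≤∧≢⇒< (≤-pred k<1+n) k≢n) (λ j j<n → others j (m<n⇒m<1+n j<n)))
                                    (others n ≤-refl (≢-sym k≢n)))
                         (+-identityʳ (f k))

  ∑<-δ : ∀ n k (f : ℕ → ℕ) → k < n → ∑< n (λ j → δ j k * f j) ≡ f k
  ∑<-δ n k f k<n = begin
    ∑< n (λ j → δ j k * f j) ≡⟨ ∑<-single n _ k k<n (λ j _ j≢k → cong (_* f j) (δ-≢ j≢k)) ⟩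
    δ k k * f k              ≡⟨ cong (_* f k) (δ-refl k) ⟩
    1 * f k                  ≡⟨ *-identityˡ (f k) ⟩
    f k                      ∎
    where open ≡-Reasoning

  ≤-∑< : ∀ n (f : ℕ → ℕ) j → j < n → f j ≤ ∑< n f
  ≤-∑< (suc n) f j j<1+n with j ≟ n
  ... | yes refl = m≤n+m (f j) (∑< j f)
  ... | no  j≢n  = ≤-trans (≤-∑< n f j (≤∧≢⇒< (≤-pred j<1+n) j≢n)) (m≤m+n (∑< n f) (f n))

  +-≤-∑< : ∀ n (f : ℕ → ℕ) j k → j < n → k < n → j ≢ k → f j + f k ≤ ∑< n f
  +-≤-∑< (suc n) f j k j<1+n k<1+n j≢k with j ≟ n | k ≟ n
  ... | yes refl | yes refl = ⊥-elim (j≢k refl)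
  ... | yes refl | no  k≢n  = ≤-trans (≤-reflexive (+-comm (f j) (f k)))
                                      (+-monoˡ-≤ (f j) (≤-∑< j f k (≤∧≢⇒< (≤-pred k<1+n) k≢n)))
  ... | no  j≢n  | yes refl = +-monoˡ-≤ (f k) (≤-∑< k f j (≤∧≢⇒< (≤-pred j<1+n) j≢n))
  ... | no  j≢n  | no  k≢n  = ≤-trans (+-≤-∑< n f j k (≤∧≢⇒< (≤-pred j<1+n) j≢n) (≤∧≢⇒< (≤-pred k<1+n) k≢n) j≢k)
                                      (m≤m+n (∑< n f) (f n))

  n≤∑<-positive : ∀ n (f : ℕ → ℕ) → (∀ j → j < n → 1 ≤ f j) → n ≤ ∑< n f
  n≤∑<-positive zero    f _   = z≤n
  n≤∑<-positive (suc n) f f≥1 = subst (_≤ ∑< n f + f n) (+-comm n 1)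
    (+-mono-≤ (n≤∑<-positive n f (λ j j<n → f≥1 j (m<n⇒m<1+n j<n))) (f≥1 n ≤-refl))

  positive-∑<≤n⇒≡1 : ∀ n (f : ℕ → ℕ) → (∀ j → j < n → 1 ≤ f j) → ∑< n f ≤ n → ∀ j → j < n → f j ≡ 1
  positive-∑<≤n⇒≡1 n f f≥1 ∑≤n j j<n = ≤-antisym (≤1 n f f≥1 ∑≤n j j<n) (f≥1 j j<n)
    where
    ≤1 : ∀ n (f : ℕ → ℕ) → (∀ j → j < n → 1 ≤ f j) → ∑< n f ≤ n → ∀ j → j < n → f j ≤ 1
    ≤1 (suc n) f f≥1 ∑≤n j j<1+n with j ≟ n
    ... | yes refl = +-cancelˡ-≤ j (f j) 1
      (≤-trans (+-monoˡ-≤ (f j) (n≤∑<-positive j f (λ i i<j → f≥1 i (m<n⇒m<1+n i<j))))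
               (subst (∑< j f + f j ≤_) (+-comm 1 j) ∑≤n))
    ... | no  j≢n  = ≤1 n f (λ i i<n → f≥1 i (m<n⇒m<1+n i<n))
      (≤-pred (≤-trans (subst (_≤ ∑< n f + f n) (+-comm (∑< n f) 1) (+-monoʳ-≤ (∑< n f) (f≥1 n ≤-refl))) ∑≤n))
      j (≤∧≢⇒< (≤-pred j<1+n) j≢n)


module Primes where

  open import Data.Nat
  open import Data.Nat.Properties
  open import Data.Nat.Divisibility
  open import Data.Nat.Primality
  open import Data.Nat.Primality.Factorisation using (factorise; PrimeFactorisation)
  open import Data.Nat.Coprimality using (Coprime)
  open import Data.Nat.ListAction using (product)
  open import Data.List using ([]; _∷_)
  open import Data.List.Relation.Unary.All using (All; _∷_)
  open import Data.Product using (∃; _×_; _,_)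
  open import Data.Sum using (inj₁; inj₂)
  open import Data.Empty using (⊥-elim)
  open import Relation.Nullary using (¬_; yes; no)
  open import Relation.Binary.PropositionalEquality

  prime≢1 : ∀ {q} → Prime q → q ≢ 1
  prime≢1 q-prime refl = ¬prime[1] q-prime

  prime∣^⇒∣ : ∀ {q a} → Prime q → ∀ k → q ∣ a ^ k → q ∣ a
  prime∣^⇒∣ q-prime zero    q∣1 = ⊥-elim (prime≢1 q-prime (∣1⇒≡1 q∣1))
  prime∣^⇒∣ {a = a} q-prime (suc k) q∣a^[1+k] with euclidsLemma a (a ^ k) q-prime q∣a^[1+k]
  ... | inj₁ q∣a   = q∣a
  ... | inj₂ q∣a^k = prime∣^⇒∣ q-prime k q∣a^k

  prime∣prime⇒≡ : ∀ {q p} → Prime q → Prime p → q ∣ p → q ≡ p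
  prime∣prime⇒≡ q-prime p-prime q∣p with prime⇒irreducible p-prime q∣p
  ... | inj₁ q≡1 = ⊥-elim (prime≢1 q-prime q≡1)
  ... | inj₂ q≡p = q≡p

  ∃prime∣ : ∀ d → d ≢ 0 → d ≢ 1 → ∃ λ q → Prime q × q ∣ d
  ∃prime∣ zero      d≢0 _   = ⊥-elim (d≢0 refl)
  ∃prime∣ d@(suc _) _   d≢1 = pick factors isFactorisation factorsPrime
    where
    open PrimeFactorisation (factorise d)
    pick : ∀ qs → d ≡ product qs → All Prime qs → ∃ λ q → Prime q × q ∣ d
    pick []       d≡1        _             = ⊥-elim (d≢1 d≡1)
    pick (q ∷ qs) d≡q*∏qs (q-prime ∷ _) = q , q-prime , subst (q ∣_) (sym d≡q*∏qs) (m∣m*n (product qs))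

  prime∤⇒coprime-^ : ∀ {p c} → Prime p → ¬ p ∣ c → ∀ k → Coprime (p ^ k) c
  prime∤⇒coprime-^ {p} {c} p-prime p∤c k {d} (d∣p^k , d∣c) with d ≟ 1
  ... | yes d≡1 = d≡1
  ... | no  d≢1 with ∃prime∣ d d≢0 d≢1
    where
    d≢0 : d ≢ 0
    d≢0 refl = <⇒≢ (m^n>0 p ⦃ prime⇒nonZero p-prime ⦄ k) (sym (0∣⇒≡0 d∣p^k))
  ... | q , q-prime , q∣d = ⊥-elim (p∤c (subst (_∣ c) (prime∣prime⇒≡ q-prime p-prime (prime∣^⇒∣ q-prime k (∣-trans q∣d d∣p^k)))
                                                       (∣-trans q∣d d∣c)))


module PrimeProducts where

  open import Defs using (∏)
  open import Data.Nat
  open import Data.Nat.Properties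
  open import Data.Nat.Divisibility
  open import Data.Nat.Primality
  open import Data.Nat.GCD using (gcd; gcd[m,n]∣m; gcd-greatest)
  open import Data.Nat.Coprimality using (Coprime)
  open import Data.Fin as Fin using (Fin)
  import Data.Fin.Properties as Fin
  open import Data.Product using (∃; _×_; _,_)
  open import Data.Sum using (inj₁; inj₂; [_,_]′)
  open import Data.Empty using (⊥-elim)
  open import Relation.Nullary using (¬_; yes; no)
  open import Relation.Binary.PropositionalEquality
  open import Function using (_∘_)
  open import Function.Definitions using (Injective)
  open Primes

  ∏-cong : ∀ K {f g : Fin K → ℕ} → (∀ i → f i ≡ g i) → ∏ K f ≡ ∏ K g
  ∏-cong zero    f≗g = refl
  ∏-cong (suc K) f≗g = cong₂ _*_ (f≗g Fin.zero) (∏-cong K (f≗g ∘ Fin.suc))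

  ∣∏ : ∀ K (f : Fin K → ℕ) i → f i ∣ ∏ K f
  ∣∏ (suc K) f Fin.zero    = m∣m*n _
  ∣∏ (suc K) f (Fin.suc i) = ∣-trans (∣∏ K (f ∘ Fin.suc) i) (n∣m*n (f Fin.zero))

  ∏-nonZero : ∀ K (f : Fin K → ℕ) → (∀ i → NonZero (f i)) → NonZero (∏ K f)
  ∏-nonZero zero    f _       = _
  ∏-nonZero (suc K) f f≢0 = m*n≢0 (f Fin.zero) (∏ K (f ∘ Fin.suc)) ⦃ f≢0 Fin.zero ⦄ ⦃ ∏-nonZero K (f ∘ Fin.suc) (f≢0 ∘ Fin.suc) ⦄

  ^-∣ : ∀ p {k n} → k ≤ n → p ^ k ∣ p ^ n
  ^-∣ p {k} {n} k≤n = divides (p ^ (n ∸ k)) (trans (cong (p ^_) (sym (m∸n+n≡m k≤n))) (^-distribˡ-+-* p (n ∸ k) k))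

  prime∣∏⇒≡ : ∀ {q} → Prime q → ∀ K (p e : Fin K → ℕ) → (∀ i → Prime (p i)) → q ∣ ∏ K (λ j → p j ^ e j) → ∃ λ i → q ≡ p i
  prime∣∏⇒≡ q-prime zero    p e p-prime q∣1 = ⊥-elim (prime≢1 q-prime (∣1⇒≡1 q∣1))
  prime∣∏⇒≡ q-prime (suc K) p e p-prime q∣∏ with euclidsLemma _ _ q-prime q∣∏
  ... | inj₁ q∣p₀^e₀ = Fin.zero , prime∣prime⇒≡ q-prime (p-prime Fin.zero) (prime∣^⇒∣ q-prime (e Fin.zero) q∣p₀^e₀)
  ... | inj₂ q∣rest with prime∣∏⇒≡ q-prime K (p ∘ Fin.suc) (e ∘ Fin.suc) (p-prime ∘ Fin.suc) q∣rest
  ...   | i , q≡pᵢ = Fin.suc i , q≡pᵢ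

  prime∤∏ : ∀ {q} → Prime q → ∀ K (p e : Fin K → ℕ) → (∀ i → Prime (p i)) → (∀ i → q ≢ p i) → ¬ q ∣ ∏ K (λ j → p j ^ e j)
  prime∤∏ q-prime K p e p-prime q≢p q∣∏ with prime∣∏⇒≡ q-prime K p e p-prime q∣∏
  ... | i , q≡pᵢ = q≢p i q≡pᵢ

  ∏-split : ∀ K (p e : Fin K → ℕ) → (∀ i → Prime (p i)) → Injective _≡_ _≡_ p → ∀ i →
            ∃ λ R → ∏ K (λ j → p j ^ e j) ≡ p i ^ e i * R × ¬ p i ∣ R
  ∏-split (suc K) p e p-prime p-injective Fin.zero =
    _ , refl , prime∤∏ (p-prime Fin.zero) K (p ∘ Fin.suc) (e ∘ Fin.suc) (p-prime ∘ Fin.suc) (λ i p₀≡pᵢ₊₁ → Fin.0≢1+n (p-injective p₀≡pᵢ₊₁))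
  ∏-split (suc K) p e p-prime p-injective (Fin.suc i)
    with ∏-split K (p ∘ Fin.suc) (e ∘ Fin.suc) (p-prime ∘ Fin.suc) (Fin.suc-injective ∘ p-injective) i
  ... | R , ∏≡pᵢ^eᵢ*R , pᵢ∤R = p₀^e₀ * R , trans (cong (p₀^e₀ *_) ∏≡pᵢ^eᵢ*R) (x∙yz≈y∙xz p₀^e₀ (p (Fin.suc i) ^ e (Fin.suc i)) R) , pᵢ∤p₀^e₀*R
    where
    open import Algebra.Properties.CommutativeSemigroup *-commutativeSemigroup using (x∙yz≈y∙xz)
    p₀^e₀ = p Fin.zero ^ e Fin.zero
    pᵢ∤p₀^e₀*R : ¬ p (Fin.suc i) ∣ p₀^e₀ * R
    pᵢ∤p₀^e₀*R pᵢ∣ = [ (λ pᵢ∣p₀^e₀ → Fin.0≢1+n (p-injective (sym (prime∣prime⇒≡ (p-prime (Fin.suc i)) (p-prime Fin.zero)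
                                                                 (prime∣^⇒∣ (p-prime (Fin.suc i)) (e Fin.zero) pᵢ∣p₀^e₀)))))
                     , pᵢ∤R ]′ (euclidsLemma _ _ (p-prime (Fin.suc i)) pᵢ∣)

  coprime-∏ : ∀ K (p e : Fin K → ℕ) → (∀ i → Prime (p i)) → ∀ {t} → (∀ i → ¬ p i ∣ t) → Coprime t (∏ K (λ j → p j ^ e j))
  coprime-∏ K p e p-prime {t} p∤t {d} (d∣t , d∣∏) with d ≟ 1
  ... | yes d≡1 = d≡1
  ... | no  d≢1 with ∃prime∣ d d≢0 d≢1
    where
    d≢0 : d ≢ 0
    d≢0 refl = ≢-nonZero⁻¹ _ ⦃ ∏-nonZero K _ (λ i → m^n≢0 (p i) (e i) ⦃ prime⇒nonZero (p-prime i) ⦄) ⦄ (0∣⇒≡0 d∣∏)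
  ... | q , q-prime , q∣d with prime∣∏⇒≡ q-prime K p e p-prime (∣-trans q∣d d∣∏)
  ...   | i , q≡pᵢ = ⊥-elim (p∤t i (subst (_∣ t) q≡pᵢ (∣-trans q∣d d∣t)))

  gcd≡∏⇒^∣ : ∀ K (p α : Fin K → ℕ) u M → gcd u M ≡ ∏ K (λ j → p j ^ α j) → ∀ i → p i ^ α i ∣ u
  gcd≡∏⇒^∣ K p α u M gcd≡∏ i = ∣-trans (∣∏ K (λ j → p j ^ α j) i) (subst (_∣ u) gcd≡∏ (gcd[m,n]∣m u M))

  gcd≡∏⇒^∤ : ∀ K (p n α : Fin K → ℕ) → (∀ i → Prime (p i)) → Injective _≡_ _≡_ p → ∀ u →
             gcd u (∏ K (λ j → p j ^ n j)) ≡ ∏ K (λ j → p j ^ α j) → ∀ i → α i < n i → ¬ p i ^ suc (α i) ∣ u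
  gcd≡∏⇒^∤ K p n α p-prime p-injective u gcd≡∏ i αᵢ<nᵢ pᵢ^[1+αᵢ]∣u with ∏-split K p α p-prime p-injective i
  ... | R , ∏≡pᵢ^αᵢ*R , pᵢ∤R =
    pᵢ∤R (*-cancelˡ-∣ (p i ^ α i) ⦃ m^n≢0 (p i) (α i) ⦄ (subst (_∣ p i ^ α i * R) (*-comm (p i) (p i ^ α i)) pᵢ^[1+αᵢ]∣pᵢ^αᵢ*R))
    where
    instance _ = prime⇒nonZero (p-prime i)
    pᵢ^[1+αᵢ]∣pᵢ^αᵢ*R : p i ^ suc (α i) ∣ p i ^ α i * R
    pᵢ^[1+αᵢ]∣pᵢ^αᵢ*R = subst (p i ^ suc (α i) ∣_) (trans gcd≡∏ ∏≡pᵢ^αᵢ*R)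
      (gcd-greatest pᵢ^[1+αᵢ]∣u (∣-trans (^-∣ (p i) αᵢ<nᵢ) (∣∏ K (λ j → p j ^ n j) i)))


module PrimeBinomial {q : ℕ} (q-prime : Prime q) where

  open import Data.Nat
  open import Data.Nat.Properties
  open import Data.Nat.DivMod
  open import Data.Nat.Divisibility
  open import Data.Nat.Primality
  open import Data.Nat.Combinatorics
  open import Data.Sum using (inj₁; inj₂)
  open import Data.Empty using (⊥-elim)
  open import Relation.Nullary using (¬_)
  open import Relation.Binary.PropositionalEquality
  open import Function using (_∘_)
  open RangeSum
  open Primes using (prime≢1)

  instance
    q≢0 : NonZero q
    q≢0 = prime⇒nonZero q-prime

  prime∤! : ∀ j → j < q → ¬ q ∣ j !
  prime∤! zero    _   q∣1 = prime≢1 q-prime (∣1⇒≡1 q∣1)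
  prime∤! (suc j) j<q q∣j! with euclidsLemma (suc j) (j !) q-prime q∣j!
  ... | inj₁ q∣1+j = <⇒≱ j<q (∣⇒≤ q∣1+j)
  ... | inj₂ q∣j!  = prime∤! j (<-trans (n<1+n j) j<q) q∣j!

  prime∣C : ∀ k → 0 < k → k < q → q ∣ q C k
  prime∣C k 0<k k<q with euclidsLemma (q C k) (k ! * (q ∸ k) !) q-prime q∣C*k!*[q∸k]!
    where
    instance _ = k !* (q ∸ k) !≢0
    q∣q! : q ∣ q !
    q∣q! = subst (λ n → n ∣ n !) (suc-pred q) (m∣m*n (pred q !))
    q∣C*k!*[q∸k]! : q ∣ (q C k) * (k ! * (q ∸ k) !)
    q∣C*k!*[q∸k]! = subst (q ∣_) (sym (trans (cong (_* (k ! * (q ∸ k) !)) (nCk≡n!/k![n-k]! (<⇒≤ k<q)))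
                                             (m/n*n≡m (k![n∸k]!∣n! (<⇒≤ k<q))))) q∣q!
  ... | inj₁ q∣C = q∣C
  ... | inj₂ q∣k!*[q∸k]! with euclidsLemma (k !) ((q ∸ k) !) q-prime q∣k!*[q∸k]!
  ...   | inj₁ q∣k!     = ⊥-elim (prime∤! k k<q q∣k!)
  ...   | inj₂ q∣[q∸k]! = ⊥-elim (prime∤! (q ∸ k) (∸-monoʳ-< 0<k (<⇒≤ k<q)) q∣[q∸k]!)

  ∣-∑< : ∀ n (g : ℕ → ℕ) → (∀ i → i < n → q ∣ g i) → q ∣ ∑< n g
  ∣-∑< zero    g _   = q ∣0
  ∣-∑< (suc n) g q∣g = ∣m∣n⇒∣m+n (∣-∑< n g (λ i i<n → q∣g i (m<n⇒m<1+n i<n))) (q∣g n ≤-refl)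

  ∑<-binomial-% : (g : ℕ → ℕ) → ∑< (suc q) (λ i → (q C i) * g i) % q ≡ (g 0 + g q) % q
  ∑<-binomial-% g = begin
    ∑< (suc q) F % q                     ≡⟨ cong (_% q) ends ⟩
    (F 0 + F q + ∑< (pred q) (F ∘ suc)) % q ≡⟨ %-remove-+ʳ (F 0 + F q) (∣-∑< (pred q) (F ∘ suc) q∣F[1+i]) ⟩
    (F 0 + F q) % q                      ≡⟨ cong₂ (λ x y → (x + y) % q) (*-identityˡ (g 0)) (trans (cong (_* g q) (nCn≡1 q)) (*-identityˡ (g q))) ⟩
    (g 0 + g q) % q                      ∎
    where
    open ≡-Reasoning
    F = λ i → (q C i) * g i
    ends : ∑< (suc q) F ≡ F 0 + F q + ∑< (pred q) (F ∘ suc)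
    ends = subst (λ n → ∑< (suc n) F ≡ F 0 + F n + ∑< (pred q) (F ∘ suc)) (suc-pred q) (∑<-ends (pred q) F)
    q∣F[1+i] : ∀ i → i < pred q → q ∣ F (suc i)
    q∣F[1+i] i i<q-1 = ∣-trans (prime∣C (suc i) (s≤s z≤n) (subst (suc (suc i) ≤_) (suc-pred q) (s≤s i<q-1))) (m∣m*n (g (suc i)))


module Residue (M : ℕ) .⦃ _ : NonZero M ⦄ where

  open import Data.Nat
  open import Data.Nat.Properties
  open import Data.Nat.DivMod
  open import Relation.Binary.PropositionalEquality
  open RangeSum using (∑<)

  infix 4 _≡ᴹ_
  _≡ᴹ_ : ℕ → ℕ → Set
  a ≡ᴹ b = a % M ≡ b % M

  %-≡ᴹ : ∀ a → a % M ≡ᴹ a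
  %-≡ᴹ a = m%n%n≡m%n a M

  +-cong-≡ᴹ : ∀ {a a′ b b′} → a ≡ᴹ a′ → b ≡ᴹ b′ → a + b ≡ᴹ a′ + b′
  +-cong-≡ᴹ {a} {a′} {b} {b′} a≡a′ b≡b′ =
    trans (%-distribˡ-+ a b M) (trans (cong₂ (λ x y → (x + y) % M) a≡a′ b≡b′) (sym (%-distribˡ-+ a′ b′ M)))

  *-cong-≡ᴹ : ∀ {a a′ b b′} → a ≡ᴹ a′ → b ≡ᴹ b′ → a * b ≡ᴹ a′ * b′
  *-cong-≡ᴹ {a} {a′} {b} {b′} a≡a′ b≡b′ =
    trans (%-distribˡ-* a b M) (trans (cong₂ (λ x y → (x * y) % M) a≡a′ b≡b′) (sym (%-distribˡ-* a′ b′ M)))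

  +-cong-≡ᴹʳ : ∀ a {b b′} → b ≡ᴹ b′ → a + b ≡ᴹ a + b′
  +-cong-≡ᴹʳ a = +-cong-≡ᴹ {a} {a} refl

  +M≡ᴹ : ∀ a → a + M ≡ᴹ a
  +M≡ᴹ a = [m+n]%n≡m%n a M

  ∑<-cong-≡ᴹ : ∀ n {f g : ℕ → ℕ} → (∀ j → j < n → f j ≡ᴹ g j) → ∑< n f ≡ᴹ ∑< n g
  ∑<-cong-≡ᴹ zero    f≡g = refl
  ∑<-cong-≡ᴹ (suc n) {f} {g} f≡g =
    +-cong-≡ᴹ {∑< n f} {∑< n g} (∑<-cong-≡ᴹ n (λ j j<n → f≡g j (m<n⇒m<1+n j<n))) (f≡g n ≤-refl)

  ≡ᴹ⇒≡ : ∀ {a b} → a < M → b < M → a ≡ᴹ b → a ≡ b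
  ≡ᴹ⇒≡ a<M b<M a≡b = trans (sym (m<n⇒m%n≡m a<M)) (trans a≡b (m<n⇒m%n≡m b<M))

  +-cancelʳ-≡ᴹ : ∀ {a b} j → a + j ≡ᴹ b + j → a ≡ᴹ b
  +-cancelʳ-≡ᴹ {a} {b} j a+j≡b+j = trans (sym (undo a)) (trans (+-cong-≡ᴹ {a + j} {b + j} a+j≡b+j refl) (undo b))
    where
    j⁻ = M ∸ j % M
    undo : ∀ x → x + j + j⁻ ≡ᴹ x
    undo x = begin
      (x + j + j⁻) % M       ≡⟨ +-cong-≡ᴹ {x + j} {x + j % M} {j⁻} (+-cong-≡ᴹʳ x (sym (%-≡ᴹ j))) refl ⟩
      (x + j % M + j⁻) % M   ≡⟨ cong (_% M) (+-assoc x (j % M) j⁻) ⟩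
      (x + (j % M + j⁻)) % M ≡⟨ cong (λ y → (x + y) % M) (m+[n∸m]≡n (<⇒≤ (m%n<n j M))) ⟩
      (x + M) % M            ≡⟨ +M≡ᴹ x ⟩
      x % M                  ∎
      where open ≡-Reasoning

  infixl 6 _⊖_
  _⊖_ : ℕ → ℕ → ℕ
  s ⊖ j = (s + (M ∸ j % M)) % M

  ⊖<M : ∀ s j → s ⊖ j < M
  ⊖<M s j = m%n<n _ M

  ⊖-+ : ∀ s j → s ⊖ j + j ≡ᴹ s
  ⊖-+ s j = begin
    (s ⊖ j + j) % M               ≡⟨ +-cong-≡ᴹ {s ⊖ j} {s + (M ∸ j % M)} {j} (%-≡ᴹ _) (sym (%-≡ᴹ j)) ⟩
    (s + (M ∸ j % M) + j % M) % M ≡⟨ cong (_% M) (+-assoc s (M ∸ j % M) (j % M)) ⟩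
    (s + (M ∸ j % M + j % M)) % M ≡⟨ cong (λ y → (s + y) % M) (m∸n+n≡m (<⇒≤ (m%n<n j M))) ⟩
    (s + M) % M                   ≡⟨ +M≡ᴹ s ⟩
    s % M                         ∎
    where open ≡-Reasoning

  ⊖-unique : ∀ {r s j} → r < M → r + j ≡ᴹ s → r ≡ s ⊖ j
  ⊖-unique {r} {s} {j} r<M r+j≡s = ≡ᴹ⇒≡ r<M (⊖<M s j) (+-cancelʳ-≡ᴹ j (trans r+j≡s (sym (⊖-+ s j))))

  ⊖-congˡ : ∀ {s s′} j → s ≡ᴹ s′ → s ⊖ j ≡ s′ ⊖ j
  ⊖-congˡ {s} j s≡s′ = ⊖-unique (⊖<M s j) (trans (⊖-+ s j) s≡s′)

  ⊖-congʳ : ∀ s {j j′} → j ≡ᴹ j′ → s ⊖ j ≡ s ⊖ j′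
  ⊖-congʳ s {j} j≡j′ = ⊖-unique (⊖<M s j) (trans (+-cong-≡ᴹʳ (s ⊖ j) (sym j≡j′)) (⊖-+ s j))

  +-⊖ : ∀ l k → l + k ⊖ k ≡ l % M
  +-⊖ l k = sym (⊖-unique (m%n<n l M) (+-cong-≡ᴹ {l % M} {l} {k} (%-≡ᴹ l) refl))

  ⊖-+-assoc : ∀ s k l → s ⊖ (l + k) ≡ s ⊖ k ⊖ l
  ⊖-+-assoc s k l = sym (⊖-unique (⊖<M _ l) (begin
    (s ⊖ k ⊖ l + (l + k)) % M ≡⟨ cong (_% M) (+-assoc (s ⊖ k ⊖ l) l k) ⟨
    (s ⊖ k ⊖ l + l + k) % M   ≡⟨ +-cong-≡ᴹ {s ⊖ k ⊖ l + l} {s ⊖ k} {k} (⊖-+ (s ⊖ k) l) refl ⟩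
    (s ⊖ k + k) % M           ≡⟨ ⊖-+ s k ⟩
    s % M                     ∎))
    where open ≡-Reasoning

  ⊖-involutive : ∀ s j → j < M → s ⊖ (s ⊖ j) ≡ j
  ⊖-involutive s j j<M = sym (⊖-unique j<M (trans (cong (_% M) (+-comm j (s ⊖ j))) (⊖-+ s j)))

  ⊖-identityʳ : ∀ s → s ⊖ 0 ≡ s % M
  ⊖-identityʳ s = sym (⊖-unique (m%n<n s M) (trans (cong (_% M) (+-identityʳ (s % M))) (%-≡ᴹ s)))

  ⊖-< : ∀ s j → j < M → s ⊖ j ≡ (s + (M ∸ j)) % M
  ⊖-< s j j<M = cong (λ x → (s + (M ∸ x)) % M) (m<n⇒m%n≡m j<M)


module GroupSemiring (M : ℕ) .⦃ _ : NonZero M ⦄ where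

  open import Data.Nat
  open import Data.Nat.Properties
  open import Data.Nat.DivMod
  open import Data.Product using (_,_)
  open import Relation.Binary.PropositionalEquality
  open import Relation.Binary.Structures using (IsEquivalence)
  open import Algebra.Bundles using (Semiring)
  open import Function using (_∘_)
  open RangeSum
  open Residue M

  -- ℕ[ℤ_M] as functions ℕ → ℕ of which only the values below M matter (see _≈_).
  ℕ[ℤₘ] : Set
  ℕ[ℤₘ] = ℕ → ℕ

  infix 4 _≈_
  _≈_ : ℕ[ℤₘ] → ℕ[ℤₘ] → Set
  f ≈ g = ∀ j → j < M → f j ≡ g j

  infixl 6 _⊕_
  _⊕_ : ℕ[ℤₘ] → ℕ[ℤₘ] → ℕ[ℤₘ]
  (f ⊕ g) j = f j + g j

  infixl 7 _⊛_
  _⊛_ : ℕ[ℤₘ] → ℕ[ℤₘ] → ℕ[ℤₘ]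
  (f ⊛ g) s = ∑< M (λ j → f j * g (s ⊖ j))

  𝟘 : ℕ[ℤₘ]
  𝟘 _ = 0

  δ[_] : ℕ → ℕ[ℤₘ]
  δ[ a ] j = δ (a % M) j

  𝟙 : ℕ[ℤₘ]
  𝟙 = δ[ 0 ]

  Periodic : (ℕ → ℕ) → Set
  Periodic F = ∀ x → F (x % M) ≡ F x

  ∑<-translate : ∀ (F : ℕ → ℕ) → Periodic F → ∀ c → ∑< M (λ l → F (l + c)) ≡ ∑< M F
  ∑<-translate F periodic zero    = ∑<-cong M (λ j _ → cong F (+-identityʳ j))
  ∑<-translate F periodic (suc c) = begin
    ∑< M (λ l → F (l + suc c))   ≡⟨ ∑<-cong M (λ j _ → cong F (+-suc j c)) ⟩
    ∑< M (G ∘ suc)               ≡⟨ +-cancelˡ-≡ (G 0) _ _ rotate ⟩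
    ∑< M G                       ≡⟨ ∑<-translate F periodic c ⟩
    ∑< M F                       ∎
    where
    open ≡-Reasoning
    G = λ l → F (l + c)
    G[M]≡G[0] : G M ≡ G 0
    G[M]≡G[0] = begin
      F (M + c)       ≡⟨ periodic (M + c) ⟨
      F ((M + c) % M) ≡⟨ cong F (trans (cong (_% M) (+-comm M c)) (+M≡ᴹ c)) ⟩
      F (c % M)       ≡⟨ periodic c ⟩
      F c             ∎
    rotate : G 0 + ∑< M (G ∘ suc) ≡ G 0 + ∑< M G
    rotate = trans (sym (∑<-suc M G)) (trans (cong (∑< M G +_) G[M]≡G[0]) (+-comm (∑< M G) (G 0)))

  ∑<-reflect : ∀ (F : ℕ → ℕ) → Periodic F → ∀ s → ∑< M (λ j → F (s ⊖ j)) ≡ ∑< M F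
  ∑<-reflect F periodic s = begin
    ∑< M (λ j → F (s ⊖ j))        ≡⟨ ∑<-cong M (λ j j<M → trans (cong F (⊖-< s j j<M)) (periodic _)) ⟩
    ∑< M (λ j → F (s + (M ∸ j)))  ≡⟨ ∑<-reverse M (λ x → F (s + x)) ⟩
    ∑< M (λ j → F (s + suc j))    ≡⟨ ∑<-cong M (λ j _ → cong F (trans (+-suc s j) (+-comm (suc s) j))) ⟩
    ∑< M (λ l → F (l + suc s))    ≡⟨ ∑<-translate F periodic (suc s) ⟩
    ∑< M F                        ∎
    where open ≡-Reasoning

  ⊛-congˡ : ∀ {f f′} g → f ≈ f′ → f ⊛ g ≈ f′ ⊛ g
  ⊛-congˡ g f≈f′ s _ = ∑<-cong M (λ j j<M → cong (_* _) (f≈f′ j j<M))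

  ⊛-congʳ : ∀ f {g g′} → g ≈ g′ → f ⊛ g ≈ f ⊛ g′
  ⊛-congʳ f g≈g′ s _ = ∑<-cong M (λ j _ → cong (f j *_) (g≈g′ _ (⊖<M s j)))

  ⊛-comm : ∀ f g → f ⊛ g ≈ g ⊛ f
  ⊛-comm f g s _ = begin
    ∑< M (λ j → f j * g (s ⊖ j))                         ≡⟨ ∑<-cong M (λ j j<M → cong (λ x → f x * g (s ⊖ j)) (sym (m<n⇒m%n≡m j<M))) ⟩
    ∑< M F                                               ≡⟨ ∑<-reflect F periodic s ⟨
    ∑< M (λ j → f ((s ⊖ j) % M) * g (s ⊖ (s ⊖ j)))       ≡⟨ ∑<-cong M (λ j j<M → trans (cong₂ _*_ (cong f (m<n⇒m%n≡m (⊖<M s j))) (cong g (⊖-involutive s j j<M)))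
                                                                                       (*-comm (f (s ⊖ j)) (g j))) ⟩
    ∑< M (λ j → g j * f (s ⊖ j))                         ∎
    where
    open ≡-Reasoning
    F = λ j → f (j % M) * g (s ⊖ j)
    periodic : Periodic F
    periodic x = cong₂ _*_ (cong f (%-≡ᴹ x)) (cong g (⊖-congʳ s (%-≡ᴹ x)))

  ⊛-assoc : ∀ f g h → (f ⊛ g) ⊛ h ≈ f ⊛ (g ⊛ h)
  ⊛-assoc f g h s _ = begin
    ∑< M (λ j → ∑< M (λ k → f k * g (j ⊖ k)) * h (s ⊖ j))   ≡⟨ ∑<-cong M (λ j _ → sym (∑<-*ʳ M (h (s ⊖ j)) _)) ⟩
    ∑< M (λ j → ∑< M (λ k → f k * g (j ⊖ k) * h (s ⊖ j)))   ≡⟨ ∑<-comm M M _ ⟩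
    ∑< M (λ k → ∑< M (λ j → f k * g (j ⊖ k) * h (s ⊖ j)))   ≡⟨ ∑<-cong M (λ k _ → trans (∑<-cong M (λ j _ → *-assoc (f k) _ _))
                                                                                   (trans (∑<-*ˡ M (f k) _) (cong (f k *_) (inner k)))) ⟩
    ∑< M (λ k → f k * (g ⊛ h) (s ⊖ k))                      ∎
    where
    open ≡-Reasoning
    inner : ∀ k → ∑< M (λ j → g (j ⊖ k) * h (s ⊖ j)) ≡ ∑< M (λ l → g l * h (s ⊖ k ⊖ l))
    inner k = trans (sym (∑<-translate (λ j → g (j ⊖ k) * h (s ⊖ j)) periodic k))
      (∑<-cong M (λ l l<M → cong₂ _*_ (cong g (trans (+-⊖ l k) (m<n⇒m%n≡m l<M))) (cong h (⊖-+-assoc s k l))))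
      where
      periodic : Periodic (λ j → g (j ⊖ k) * h (s ⊖ j))
      periodic x = cong₂ _*_ (cong g (⊖-congˡ k (%-≡ᴹ x))) (cong h (⊖-congʳ s (%-≡ᴹ x)))

  ⊛-distribˡ : ∀ f g h → f ⊛ (g ⊕ h) ≈ f ⊛ g ⊕ f ⊛ h
  ⊛-distribˡ f g h s _ = trans (∑<-cong M (λ j _ → *-distribˡ-+ (f j) _ _)) (∑<-distrib-+ M _ _)

  ⊛-distribʳ : ∀ f g h → (g ⊕ h) ⊛ f ≈ g ⊛ f ⊕ h ⊛ f
  ⊛-distribʳ f g h s _ = trans (∑<-cong M (λ j _ → *-distribʳ-+ (f (s ⊖ j)) (g j) _)) (∑<-distrib-+ M _ _)

  ⊛-identityˡ : ∀ f → 𝟙 ⊛ f ≈ f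
  ⊛-identityˡ f s s<M = begin
    ∑< M (λ j → δ (0 % M) j * f (s ⊖ j)) ≡⟨ ∑<-cong M (λ j _ → trans (cong (λ x → δ x j * f (s ⊖ j)) 0%M≡0) (cong (_* f (s ⊖ j)) (δ-sym 0 j))) ⟩
    ∑< M (λ j → δ j 0 * f (s ⊖ j))       ≡⟨ ∑<-δ M 0 (λ j → f (s ⊖ j)) 0<M ⟩
    f (s ⊖ 0)                            ≡⟨ cong f (trans (⊖-identityʳ s) (m<n⇒m%n≡m s<M)) ⟩
    f s                                  ∎
    where
    open ≡-Reasoning
    0<M : 0 < M
    0<M = ≤-<-trans z≤n s<M
    0%M≡0 : 0 % M ≡ 0
    0%M≡0 = m<n⇒m%n≡m 0<M

  ⊛-identityʳ : ∀ f → f ⊛ 𝟙 ≈ f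
  ⊛-identityʳ f s s<M = trans (⊛-comm f 𝟙 s s<M) (⊛-identityˡ f s s<M)

  ⊛-zeroˡ : ∀ f → 𝟘 ⊛ f ≈ 𝟘
  ⊛-zeroˡ f s _ = ∑<-zero M

  ⊛-zeroʳ : ∀ f → f ⊛ 𝟘 ≈ 𝟘
  ⊛-zeroʳ f s _ = trans (∑<-cong M (λ j _ → *-zeroʳ (f j))) (∑<-zero M)

  ≈-isEquivalence : IsEquivalence _≈_
  ≈-isEquivalence = record
    { refl  = λ j _ → refl
    ; sym   = λ f≈g j j<M → sym (f≈g j j<M)
    ; trans = λ f≈g g≈h j j<M → trans (f≈g j j<M) (g≈h j j<M)
    }

  ℕ[ℤₘ]-semiring : Semiring _ _
  ℕ[ℤₘ]-semiring = record
    { Carrier = ℕ[ℤₘ] ; _≈_ = _≈_ ; _+_ = _⊕_ ; _*_ = _⊛_ ; 0# = 𝟘 ; 1# = 𝟙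
    ; isSemiring = record
      { isSemiringWithoutAnnihilatingZero = record
        { +-isCommutativeMonoid = record
          { isMonoid = record
            { isSemigroup = record
              { isMagma = record
                { isEquivalence = ≈-isEquivalence
                ; ∙-cong = λ f≈f′ g≈g′ j j<M → cong₂ _+_ (f≈f′ j j<M) (g≈g′ j j<M)
                }
              ; assoc = λ f g h j _ → +-assoc (f j) (g j) (h j)
              }
            ; identity = (λ f j _ → refl) , (λ f j _ → +-identityʳ (f j))
            }
          ; comm = λ f g j _ → +-comm (f j) (g j)
          }
        ; *-cong = λ {f} {f′} {g} f≈f′ g≈g′ j j<M → trans (⊛-congˡ g f≈f′ j j<M) (⊛-congʳ f′ g≈g′ j j<M)
        ; *-assoc = ⊛-assoc
        ; *-identity = ⊛-identityˡ , ⊛-identityʳ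
        ; distrib = ⊛-distribˡ , ⊛-distribʳ
        }
      ; zero = ⊛-zeroˡ , ⊛-zeroʳ
      }
    }


module Dilation (M : ℕ) .⦃ _ : NonZero M ⦄ where

  open import Data.Nat hiding (_^_)
  import Data.Nat as ℕ
  open import Data.Nat.Properties
  open import Data.Nat.DivMod
  open import Data.Nat.Divisibility
  open import Data.Nat.Combinatorics using (_C_)
  open import Data.Nat.ListAction using (product)
  open import Data.Nat.ListAction.Properties using (∈⇒∣product)
  open import Data.Fin as Fin using (Fin; toℕ)
  open import Data.List using (List; []; _∷_; map; length)
  open import Data.List.Properties using (length-map; map-∘; map-id; map-cong)
  open import Data.List.Membership.Propositional using (_∈_)
  open import Data.List.Relation.Unary.All as All using (All; []; _∷_)
  open import Data.List.Relation.Unary.Any using (here; there)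
  open import Data.Nat.Coprimality using (Coprime)
  open import Data.Nat.Primality.Factorisation using (factorise; PrimeFactorisation)
  open import Data.Product using (_,_)
  open import Data.Empty using (⊥-elim)
  open import Relation.Nullary using (¬_; yes; no)
  open import Relation.Binary.PropositionalEquality
  open import Function using (_∘_)
  open import Algebra.Bundles using (Semiring)
  import Algebra.Properties.Semiring.Binomial as Binomial
  open RangeSum
  open Primes using (prime≢1; prime∣^⇒∣)
  open Residue M
  open GroupSemiring M
  open import Algebra.Definitions.RawSemiring (Semiring.rawSemiring ℕ[ℤₘ]-semiring) using (_^_; _×_; sum)

  δ[]-⊛ : ∀ a b → δ[ a ] ⊛ δ[ b ] ≈ δ[ a + b ]
  δ[]-⊛ a b s s<M = begin
    ∑< M (λ j → δ (a % M) j * δ (b % M) (s ⊖ j)) ≡⟨ ∑<-cong M (λ j _ → cong (_* δ (b % M) (s ⊖ j)) (δ-sym (a % M) j)) ⟩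
    ∑< M (λ j → δ j (a % M) * δ (b % M) (s ⊖ j)) ≡⟨ ∑<-δ M (a % M) (λ j → δ (b % M) (s ⊖ j)) (m%n<n a M) ⟩
    δ (b % M) (s ⊖ a % M)                        ≡⟨ δ-cong to from ⟩
    δ ((a + b) % M) s                            ∎
    where
    open ≡-Reasoning
    to : b % M ≡ s ⊖ a % M → (a + b) % M ≡ s
    to b≡s-a = begin
      (a + b) % M             ≡⟨ +-cong-≡ᴹ {a} {a % M} (sym (%-≡ᴹ a)) (trans b≡s-a (sym (%-≡ᴹ _))) ⟩
      (a % M + (s ⊖ a % M)) % M ≡⟨ cong (_% M) (+-comm (a % M) _) ⟩
      (s ⊖ a % M + a % M) % M ≡⟨ ⊖-+ s (a % M) ⟩
      s % M                   ≡⟨ m<n⇒m%n≡m s<M ⟩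
      s                       ∎
    from : (a + b) % M ≡ s → b % M ≡ s ⊖ a % M
    from a+b≡s = ⊖-unique (m%n<n b M)
      (trans (+-cong-≡ᴹ {b % M} {b} (%-≡ᴹ b) (%-≡ᴹ a)) (trans (cong (_% M) (+-comm b a)) (trans a+b≡s (sym (m<n⇒m%n≡m s<M)))))

  δ[]-^ : ∀ a n → δ[ a ] ^ n ≈ δ[ n * a ]
  δ[]-^ a zero    j _   = refl
  δ[]-^ a (suc n) j j<M = trans (⊛-congʳ δ[ a ] (δ[]-^ a n) j j<M) (δ[]-⊛ a (n * a) j j<M)

  mask : List ℕ → ℕ[ℤₘ]
  mask []      = 𝟘
  mask (a ∷ L) = δ[ a ] ⊕ mask L

  sum-apply : ∀ n (V : Fin n → ℕ[ℤₘ]) (g : ℕ → ℕ) j → (∀ k → V k j ≡ g (toℕ k)) → sum V j ≡ ∑< n g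
  sum-apply zero    V g j _     = refl
  sum-apply (suc n) V g j V≗g = begin
    V Fin.zero j + sum (V ∘ Fin.suc) j ≡⟨ cong₂ _+_ (V≗g Fin.zero) (sum-apply n (V ∘ Fin.suc) (g ∘ suc) j (V≗g ∘ Fin.suc)) ⟩
    g 0 + ∑< n (g ∘ suc)               ≡⟨ ∑<-suc n g ⟨
    ∑< (suc n) g                       ∎
    where open ≡-Reasoning

  ×-apply : ∀ n f j → (n × f) j ≡ n * f j
  ×-apply zero    f j = refl
  ×-apply (suc n) f j = cong (f j +_) (×-apply n f j)

  module _ {q : ℕ} (q-prime : Prime q) where

    open PrimeBinomial q-prime using (q≢0; ∑<-binomial-%)

    frobenius : ∀ L j → j < M → (mask L ^ q) j % q ≡ mask (map (q *_) L) j % q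
    frobenius []      j j<M = cong (_% q) (subst (λ n → (𝟘 ^ n) j ≡ 0) (suc-pred q) (⊛-zeroˡ (𝟘 ^ pred q) j j<M))
    frobenius (a ∷ L) j j<M = begin
      ((x ⊕ y) ^ q) j % q                        ≡⟨ cong (_% q) (theorem (⊛-comm x y) q j j<M) ⟩
      binomialExpansion q j % q                  ≡⟨ cong (_% q) (sum-apply (suc q) (binomialTerm q) (λ i → (q C i) * g i) j
                                                                           (λ k → ×-apply (q C toℕ k) (binomial q k) j)) ⟩
      ∑< (suc q) (λ i → (q C i) * g i) % q       ≡⟨ ∑<-binomial-% g ⟩
      (g 0 + g q) % q                            ≡⟨ cong₂ (λ u v → (u + v) % q) (⊛-identityˡ (y ^ q) j j<M) g[q]≡δ[qa] ⟩
      ((y ^ q) j + δ[ q * a ] j) % q             ≡⟨ +-cong-% (frobenius L j j<M) ⟩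
      (mask (map (q *_) L) j + δ[ q * a ] j) % q ≡⟨ cong (_% q) (+-comm _ (δ[ q * a ] j)) ⟩
      mask (map (q *_) (a ∷ L)) j % q            ∎
      where
      open ≡-Reasoning
      x = δ[ a ]
      y = mask L
      open Binomial ℕ[ℤₘ]-semiring x y using (theorem; binomialExpansion; binomialTerm; binomial)
      g : ℕ → ℕ
      g i = (x ^ i ⊛ y ^ (q ∸ i)) j
      g[q]≡δ[qa] : g q ≡ δ[ q * a ] j
      g[q]≡δ[qa] = begin
        (x ^ q ⊛ y ^ (q ∸ q)) j ≡⟨ cong (λ n → (x ^ q ⊛ y ^ n) j) (n∸n≡0 q) ⟩
        (x ^ q ⊛ 𝟙) j           ≡⟨ ⊛-identityʳ (x ^ q) j j<M ⟩
        (x ^ q) j               ≡⟨ δ[]-^ a q j j<M ⟩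
        δ[ q * a ] j            ∎
      +-cong-% : ∀ {u u′} → u % q ≡ u′ % q → (u + δ[ q * a ] j) % q ≡ (u′ + δ[ q * a ] j) % q
      +-cong-% {u} {u′} u≡u′ = Residue.+-cong-≡ᴹ q {u} {u′} u≡u′ refl

  total : ℕ[ℤₘ] → ℕ
  total f = ∑< M f

  uniform : ℕ[ℤₘ]
  uniform _ = 1

  total-uniform : total uniform ≡ M
  total-uniform = trans (∑<-const M 1) (*-identityʳ M)

  ⊛-uniform : ∀ f s → (f ⊛ uniform) s ≡ total f
  ⊛-uniform f s = ∑<-cong M (λ j _ → *-identityʳ (f j))

  total-⊛ : ∀ f g → total (f ⊛ g) ≡ total f * total g
  total-⊛ f g = begin
    ∑< M (λ s → ∑< M (λ j → f j * g (s ⊖ j))) ≡⟨ ∑<-comm M M _ ⟩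
    ∑< M (λ j → ∑< M (λ s → f j * g (s ⊖ j))) ≡⟨ ∑<-cong M (λ j _ → trans (∑<-*ˡ M (f j) _) (cong (f j *_) (translate j))) ⟩
    ∑< M (λ j → f j * total g)                ≡⟨ ∑<-*ʳ M (total g) f ⟩
    total f * total g                         ∎
    where
    open ≡-Reasoning
    translate : ∀ j → ∑< M (λ s → g (s ⊖ j)) ≡ total g
    translate j = trans (sym (∑<-translate (λ s → g (s ⊖ j)) (λ x → cong g (⊖-congˡ j (%-≡ᴹ x))) j))
      (∑<-cong M (λ l l<M → cong g (trans (+-⊖ l j) (m<n⇒m%n≡m l<M))))

  total-δ[] : ∀ a → total δ[ a ] ≡ 1
  total-δ[] a = trans (∑<-cong M (λ j _ → trans (δ-sym (a % M) j) (sym (*-identityʳ (δ j (a % M))))))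
                      (∑<-δ M (a % M) (λ _ → 1) (m%n<n a M))

  total-mask : ∀ L → total (mask L) ≡ length L
  total-mask []      = ∑<-zero M
  total-mask (a ∷ L) = trans (∑<-distrib-+ M δ[ a ] (mask L)) (cong₂ _+_ (total-δ[] a) (total-mask L))

  total-^ : ∀ f n → total (f ^ n) ≡ total f ℕ.^ n
  total-^ f zero    = total-δ[] 0
  total-^ f (suc n) = trans (total-⊛ f (f ^ n)) (cong (total f *_) (total-^ f n))

  dilate-by-prime : ∀ {q} → Prime q → ¬ q ∣ M → ∀ L g → mask L ⊛ g ≈ uniform → mask (map (q *_) L) ⊛ g ≈ uniform
  dilate-by-prime {q} q-prime q∤M L g f⊛g≈1 = positive-∑<≤n⇒≡1 M F F-positive (≤-reflexive total-F)
    where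
    open PrimeBinomial q-prime using (q≢0)
    f = mask L
    F = mask (map (q *_) L) ⊛ g
    |L|*total-g≡M : length L * total g ≡ M
    |L|*total-g≡M = begin
      length L * total g  ≡⟨ cong (_* total g) (total-mask L) ⟨
      total f * total g   ≡⟨ total-⊛ f g ⟨
      total (f ⊛ g)       ≡⟨ ∑<-cong M f⊛g≈1 ⟩
      total uniform       ≡⟨ total-uniform ⟩
      M                   ∎
      where open ≡-Reasoning
    total-F : total F ≡ M
    total-F = trans (total-⊛ _ g) (trans (cong (_* total g) (trans (total-mask (map (q *_) L)) (length-map (q *_) L))) |L|*total-g≡M)
    f^q⊛g : ∀ s → s < M → (f ^ q ⊛ g) s ≡ length L ℕ.^ pred q
    f^q⊛g s s<M = begin
      (f ^ q ⊛ g) s                 ≡⟨ cong (λ n → (f ^ n ⊛ g) s) (suc-pred q) ⟨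
      (f ⊛ f ^ pred q ⊛ g) s        ≡⟨ ⊛-congˡ g (⊛-comm f (f ^ pred q)) s s<M ⟩
      (f ^ pred q ⊛ f ⊛ g) s        ≡⟨ ⊛-assoc (f ^ pred q) f g s s<M ⟩
      (f ^ pred q ⊛ (f ⊛ g)) s      ≡⟨ ⊛-congʳ (f ^ pred q) f⊛g≈1 s s<M ⟩
      (f ^ pred q ⊛ uniform) s      ≡⟨ ⊛-uniform (f ^ pred q) s ⟩
      total (f ^ pred q)            ≡⟨ total-^ f (pred q) ⟩
      total f ℕ.^ pred q            ≡⟨ cong (ℕ._^ pred q) (total-mask L) ⟩
      length L ℕ.^ pred q           ∎
      where open ≡-Reasoning
    F≡f^q⊛g : ∀ s → F s % q ≡ (f ^ q ⊛ g) s % q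
    F≡f^q⊛g s = Residue.∑<-cong-≡ᴹ q M (λ j j<M →
      Residue.*-cong-≡ᴹ q {mask (map (q *_) L) j} {(f ^ q) j} (sym (frobenius q-prime L j j<M)) refl)
    F-positive : ∀ s → s < M → 1 ≤ F s
    F-positive s s<M with F s in F[s]≡
    ... | suc _ = s≤s z≤n
    ... | zero  = ⊥-elim (q∤M (subst (q ∣_) |L|*total-g≡M (∣-trans q∣|L| (m∣m*n (total g)))))
      where
      q∣|L|^[q-1] : q ∣ length L ℕ.^ pred q
      q∣|L|^[q-1] = m%n≡0⇒n∣m _ q (trans (sym (cong (_% q) (f^q⊛g s s<M))) (trans (sym (F≡f^q⊛g s)) (trans (cong (_% q) F[s]≡) (m*n%n≡0 0 q))))
      q∣|L| : q ∣ length L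
      q∣|L| = prime∣^⇒∣ q-prime (pred q) q∣|L|^[q-1]

  dilate : ∀ {qs} → All Prime qs → All (λ q → ¬ q ∣ M) qs → ∀ L g → mask L ⊛ g ≈ uniform → mask (map (product qs *_) L) ⊛ g ≈ uniform
  dilate {[]}     []                 []          L g L⊛g≈1 = subst (λ L′ → mask L′ ⊛ g ≈ uniform) (sym (trans (map-cong *-identityˡ L) (map-id L))) L⊛g≈1
  dilate {q ∷ qs} (q-prime ∷ primes) (q∤M ∷ ∤M) L g L⊛g≈1 =
    subst (λ L′ → mask L′ ⊛ g ≈ uniform) (trans (sym (map-∘ L)) (map-cong (λ a → sym (*-assoc q (product qs) a)) L))
          (dilate-by-prime q-prime q∤M (map (product qs *_) L) g (dilate primes ∤M L g L⊛g≈1))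

  coprime-dilate : ∀ t .⦃ _ : NonZero t ⦄ → Coprime t M → ∀ L g → mask L ⊛ g ≈ uniform → mask (map (t *_) L) ⊛ g ≈ uniform
  coprime-dilate t coprime L g L⊛g≈1 =
    subst (λ n → mask (map (n *_) L) ⊛ g ≈ uniform) (sym isFactorisation) (dilate factorsPrime factors∤M L g L⊛g≈1)
    where
    open PrimeFactorisation (factorise t)
    factors∤M : All (λ q → ¬ q ∣ M) factors
    factors∤M = All.tabulate (λ {q} q∈factors q∣M → prime≢1 (All.lookup factorsPrime q∈factors)
      (coprime (subst (q ∣_) (sym isFactorisation) (∈⇒∣product q∈factors) , q∣M)))

  mask-∈ : ∀ {a L} → a ∈ L → 1 ≤ mask L (a % M)
  mask-∈ {a}         (here refl) = ≤-trans (≤-reflexive (sym (δ-refl (a % M)))) (m≤m+n _ _)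
  mask-∈ {a} {b ∷ L} (there a∈L) = ≤-trans (mask-∈ a∈L) (m≤n+m _ (δ[ b ] (a % M)))

  -- Distinct residues a, a′ of T with a + b′ ≡ a′ + b would cover the residue a + b′ twice.
  ⊛-uniform-unique : ∀ T g {a a′ b b′} → mask T ⊛ g ≈ uniform → a ∈ T → a′ ∈ T → b < M → b′ < M → 1 ≤ g b → 1 ≤ g b′ →
                     a + b′ ≡ᴹ a′ + b → a ≡ᴹ a′
  ⊛-uniform-unique T g {a} {a′} {b} {b′} T⊛g≈1 a∈T a′∈T b<M b′<M g[b]≥1 g[b′]≥1 a+b′≡a′+b with a % M ≟ a′ % M
  ... | yes a≡a′ = a≡a′
  ... | no  a≢a′ = ⊥-elim (<-irrefl refl (≤-trans 2≤F[s] (≤-reflexive (T⊛g≈1 s (m%n<n (a + b′) M)))))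
    where
    s = (a + b′) % M
    s⊖a≡b′ : s ⊖ a % M ≡ b′
    s⊖a≡b′ = sym (⊖-unique b′<M (trans (+-cong-≡ᴹʳ b′ (%-≡ᴹ a)) (trans (cong (_% M) (+-comm b′ a)) (sym (%-≡ᴹ (a + b′))))))
    s⊖a′≡b : s ⊖ a′ % M ≡ b
    s⊖a′≡b = sym (⊖-unique b<M (trans (+-cong-≡ᴹʳ b (%-≡ᴹ a′)) (trans (cong (_% M) (+-comm b a′)) (trans (sym a+b′≡a′+b) (sym (%-≡ᴹ (a + b′)))))))
    2≤F[s] : 2 ≤ (mask T ⊛ g) s
    2≤F[s] = ≤-trans (+-mono-≤ (*-mono-≤ (mask-∈ a∈T) (subst (λ x → 1 ≤ g x) (sym s⊖a≡b′) g[b′]≥1))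
                               (*-mono-≤ (mask-∈ a′∈T) (subst (λ x → 1 ≤ g x) (sym s⊖a′≡b) g[b]≥1)))
                     (+-≤-∑< M _ (a % M) (a′ % M) (m%n<n a M) (m%n<n a′ M) a≢a′)


module Tiling (M : ℕ) .⦃ _ : NonZero M ⦄ where

  open import Defs using (IsTiling; AddMod)
  open import Data.Nat
  open import Data.Nat.Properties
  open import Data.Nat.DivMod
  open import Data.Nat.Coprimality using (Coprime)
  open import Data.Fin using (Fin; toℕ; fromℕ<)
  open import Data.Fin.Properties using (toℕ<n; toℕ-fromℕ<; fromℕ<-toℕ)
  open import Data.Fin.Subset using (Subset; _∈_)
  open import Data.Fin.Subset.Properties using (_∈?_)
  open import Data.List using (List; []; _∷_; map)
  open import Data.List.Membership.Propositional.Properties using (∈-map⁺)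
  import Data.List.Membership.Propositional as List
  open import Data.List.Relation.Unary.Any using (here; there)
  open import Data.Product using (Σ; _×_; _,_; proj₁)
  open import Data.Sum using (_⊎_; inj₁; inj₂)
  open import Data.Empty using (⊥-elim)
  open import Relation.Nullary using (yes; no)
  open import Relation.Binary.PropositionalEquality
  open RangeSum
  open Residue M
  open GroupSemiring M
  open Dilation M

  indicator : Subset M → ℕ[ℤₘ]
  indicator X j with j <? M
  ... | no  _   = 0
  ... | yes j<M with fromℕ< j<M ∈? X
  ...   | yes _ = 1
  ...   | no  _ = 0

  indicator-∈ : ∀ X (i : Fin M) → i ∈ X → indicator X (toℕ i) ≡ 1
  indicator-∈ X i i∈X with toℕ i <? M
  ... | no  i≮M = ⊥-elim (i≮M (toℕ<n i))
  ... | yes i<M with fromℕ< i<M ∈? X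
  ...   | yes _ = refl
  ...   | no  i∉X = ⊥-elim (i∉X (subst (_∈ X) (sym (fromℕ<-toℕ i i<M)) i∈X))

  indicator-cases : ∀ X j → indicator X j ≡ 0 ⊎ Σ (j < M) (λ j<M → fromℕ< j<M ∈ X × indicator X j ≡ 1)
  indicator-cases X j with j <? M
  ... | no  _   = inj₁ refl
  ... | yes j<M with fromℕ< j<M ∈? X
  ...   | yes j∈X = inj₂ (j<M , j∈X , refl)
  ...   | no  _   = inj₁ refl

  elements : Subset M → ℕ → List ℕ
  elements X zero    = []
  elements X (suc k) = cons-if (indicator X k) (elements X k)
    where
    cons-if : ℕ → List ℕ → List ℕ
    cons-if zero    L = L
    cons-if (suc _) L = k ∷ L

  mask-elements-∑< : ∀ X k j → mask (elements X k) j ≡ ∑< k (λ i → indicator X i * δ[ i ] j)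
  mask-elements-∑< X zero    j = refl
  mask-elements-∑< X (suc k) j with indicator-cases X k
  ... | inj₁ χ≡0 rewrite χ≡0 = trans (mask-elements-∑< X k j) (sym (+-identityʳ _))
  ... | inj₂ (_ , _ , χ≡1) rewrite χ≡1 =
    trans (+-comm (δ[ k ] j) _) (cong₂ _+_ (mask-elements-∑< X k j) (sym (+-identityʳ (δ[ k ] j))))

  mask-elements : ∀ X → mask (elements X M) ≈ indicator X
  mask-elements X j j<M = begin
    mask (elements X M) j                     ≡⟨ mask-elements-∑< X M j ⟩
    ∑< M (λ i → indicator X i * δ[ i ] j)     ≡⟨ ∑<-single M _ j j<M (λ i i<M i≢j → trans (cong (indicator X i *_) (δ[i][j] i<M i≢j))
                                                                                       (*-zeroʳ (indicator X i))) ⟩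
    indicator X j * δ[ j ] j                  ≡⟨ cong (indicator X j *_) (trans (cong (λ x → δ x j) (m<n⇒m%n≡m j<M)) (δ-refl j)) ⟩
    indicator X j * 1                         ≡⟨ *-identityʳ (indicator X j) ⟩
    indicator X j                             ∎
    where
    open ≡-Reasoning
    δ[i][j] : ∀ {i} → i < M → i ≢ j → δ[ i ] j ≡ 0
    δ[i][j] i<M i≢j = trans (cong (λ x → δ x j) (m<n⇒m%n≡m i<M)) (δ-≢ i≢j)

  ∈-elements : ∀ X k j → j < k → indicator X j ≡ 1 → j List.∈ elements X k
  ∈-elements X (suc k) j j<1+k χ[j]≡1 with indicator X k in χ[k]≡ | j ≟ k
  ... | zero  | yes refl = ⊥-elim (1+n≢0 (trans (sym χ[j]≡1) χ[k]≡))
  ... | suc _ | yes refl = here refl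
  ... | zero  | no  j≢k  = ∈-elements X k j (≤∧≢⇒< (≤-pred j<1+k) j≢k) χ[j]≡1
  ... | suc _ | no  j≢k  = there (∈-elements X k j (≤∧≢⇒< (≤-pred j<1+k) j≢k) χ[j]≡1)

  AddMod⇒≡ᴹ : ∀ {a b z : Fin M} → AddMod M a b z → toℕ a + toℕ b ≡ᴹ toℕ z
  AddMod⇒≡ᴹ (inj₁ a+b≡z)   = cong (_% M) a+b≡z
  AddMod⇒≡ᴹ (inj₂ a+b≡z+M) = trans (cong (_% M) a+b≡z+M) (+M≡ᴹ _)

  ≡ᴹ⇒AddMod : ∀ {x y s} → x < M → y < M → s < M → x + y ≡ᴹ s → (x + y ≡ s) ⊎ (x + y ≡ s + M)
  ≡ᴹ⇒AddMod {x} {y} {s} x<M y<M s<M x+y≡s with x + y <? M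
  ... | yes x+y<M = inj₁ (≡ᴹ⇒≡ x+y<M s<M x+y≡s)
  ... | no  x+y≮M = inj₂ (begin
    x + y           ≡⟨ m∸n+n≡m M≤x+y ⟨
    x + y ∸ M + M   ≡⟨ cong (_+ M) (≡ᴹ⇒≡ x+y∸M<M s<M (trans (sym (+M≡ᴹ (x + y ∸ M))) (trans (cong (_% M) (m∸n+n≡m M≤x+y)) x+y≡s))) ⟩
    s + M           ∎)
    where
    open ≡-Reasoning
    M≤x+y = ≮⇒≥ x+y≮M
    x+y∸M<M : x + y ∸ M < M
    x+y∸M<M = +-cancelʳ-< M (x + y ∸ M) M (subst (_< M + M) (sym (m∸n+n≡m M≤x+y)) (+-mono-< x<M y<M))

  tiling⇒⊛-uniform : ∀ A B → IsTiling M A B → indicator A ⊛ indicator B ≈ uniform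
  tiling⇒⊛-uniform A B (cover , unique) s s<M with cover (fromℕ< s<M)
  ... | a , b , a∈A , b∈B , a+b≡s = trans (∑<-single M F (toℕ a) (toℕ<n a) F[j]≡0) F[a]≡1
    where
    F = λ j → indicator A j * indicator B (s ⊖ j)
    s⊖a≡b : s ⊖ toℕ a ≡ toℕ b
    s⊖a≡b = sym (⊖-unique (toℕ<n b) (trans (cong (_% M) (+-comm (toℕ b) (toℕ a)))
                                            (trans (AddMod⇒≡ᴹ {a} {b} a+b≡s) (cong (_% M) (toℕ-fromℕ< s<M)))))
    F[a]≡1 : F (toℕ a) ≡ 1
    F[a]≡1 = cong₂ _*_ (indicator-∈ A a a∈A) (trans (cong (indicator B) s⊖a≡b) (indicator-∈ B b b∈B))
    F[j]≡0 : ∀ j → j < M → j ≢ toℕ a → F j ≡ 0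
    F[j]≡0 j j<M j≢a with indicator-cases A j | indicator-cases B (s ⊖ j)
    ... | inj₁ χ≡0 | _         = cong (_* indicator B (s ⊖ j)) χ≡0
    ... | inj₂ _   | inj₁ χ≡0  = trans (cong (indicator A j *_) χ≡0) (*-zeroʳ (indicator A j))
    ... | inj₂ (j<M′ , j∈A , _) | inj₂ (s⊖j<M , s⊖j∈B , _) =
      ⊥-elim (j≢a (trans (sym (toℕ-fromℕ< j<M′)) (cong toℕ (proj₁ (unique _ _ a _ b j∈A a∈A s⊖j∈B b∈B j+[s⊖j]≡s a+b≡s)))))
      where
      j+[s⊖j]≡s : AddMod M (fromℕ< j<M′) (fromℕ< s⊖j<M) (fromℕ< s<M)
      j+[s⊖j]≡s rewrite toℕ-fromℕ< j<M′ | toℕ-fromℕ< s⊖j<M | toℕ-fromℕ< s<M =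
        ≡ᴹ⇒AddMod j<M (⊖<M s j) s<M (trans (cong (_% M) (+-comm j (s ⊖ j))) (⊖-+ s j))

  dilation-cancel : ∀ {A B} → IsTiling M A B → ∀ t → Coprime t M → ∀ {a a′ b b′ : Fin M} → a ∈ A → a′ ∈ A → b ∈ B → b′ ∈ B →
                    t * toℕ a′ + toℕ b ≡ᴹ t * toℕ a + toℕ b′ → toℕ b ≡ toℕ b′
  dilation-cancel {A} {B} tiling t coprime {a} {a′} {b} {b′} a∈A a′∈A b∈B b′∈B ta′+b≡ta+b′ =
    ≡ᴹ⇒≡ (toℕ<n b) (toℕ<n b′) (+-cancelʳ-≡ᴹ (t * toℕ a′) (begin
      (toℕ b + t * toℕ a′) % M  ≡⟨ cong (_% M) (+-comm (toℕ b) _) ⟩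
      (t * toℕ a′ + toℕ b) % M  ≡⟨ ta′+b≡ta+b′ ⟩
      (t * toℕ a + toℕ b′) % M  ≡⟨ +-cong-≡ᴹ {t * toℕ a} {t * toℕ a′} (ta≡ta′ t coprime ta′+b≡ta+b′) refl ⟩
      (t * toℕ a′ + toℕ b′) % M ≡⟨ cong (_% M) (+-comm _ (toℕ b′)) ⟩
      (toℕ b′ + t * toℕ a′) % M ∎))
    where
    open ≡-Reasoning
    L = elements A M
    L⊛B≈1 : mask L ⊛ indicator B ≈ uniform
    L⊛B≈1 s s<M = trans (⊛-congˡ (indicator B) (mask-elements A) s s<M) (tiling⇒⊛-uniform A B tiling s s<M)
    t*∈ : ∀ t i → i ∈ A → t * toℕ i List.∈ map (t *_) L
    t*∈ t i i∈A = ∈-map⁺ (t *_) (∈-elements A M (toℕ i) (toℕ<n i) (indicator-∈ A i i∈A))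
    indicator≥1 : ∀ i → i ∈ B → 1 ≤ indicator B (toℕ i)
    indicator≥1 i i∈B = ≤-reflexive (sym (indicator-∈ B i i∈B))
    ta≡ta′ : ∀ t → Coprime t M → t * toℕ a′ + toℕ b ≡ᴹ t * toℕ a + toℕ b′ → t * toℕ a ≡ᴹ t * toℕ a′
    ta≡ta′ zero      _       _ = refl
    ta≡ta′ t@(suc _) coprime ta′+b≡ta+b′ =
      ⊛-uniform-unique (map (t *_) L) (indicator B) (coprime-dilate t coprime L (indicator B) L⊛B≈1)
        (t*∈ t a a∈A) (t*∈ t a′ a′∈A) (toℕ<n b) (toℕ<n b′) (indicator≥1 b b∈B) (indicator≥1 b′ b′∈B) (sym ta′+b≡ta+b′)


module IntegerDivisibility where

  open import Data.Nat as ℕ using (ℕ; zero; suc)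
  import Data.Nat.Properties as ℕ
  import Data.Nat.Divisibility as ℕ
  open import Data.Nat.Primality using (Prime; euclidsLemma)
  open import Data.Nat.Coprimality using (Coprime; coprime-Bézout; coprime-divisor)
  import Data.Nat.Coprimality as Coprimality
  open import Data.Nat.GCD using (module Bézout)
  open import Data.Integer using (ℤ; +_; _+_; _*_; -_; _-_; 1ℤ) renaming (∣_∣ to abs)
  open import Data.Integer.Properties using (pos-*; pos-+; +∣i∣≡i⊎+∣i∣≡-i; abs-*; *-identityʳ; *-assoc)
  open import Data.Integer.Divisibility.Signed
  open import Data.Integer.Tactic.RingSolver using (solve-∀)
  open import Data.Product using (∃; ∃₂; _×_; _,_; proj₁; proj₂)
  open import Data.Sum using (_⊎_; inj₁; inj₂; [_,_]′)
  open import Relation.Nullary using (¬_)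
  open import Relation.Binary.PropositionalEquality
  open import Defs using (∏)
  open import Data.Fin as Fin using (Fin)
  import Data.Fin.Properties as Fin
  open import Function using (_∘_)
  open import Function.Definitions using (Injective)
  open Primes using (prime≢1; prime∤⇒coprime-^)
  open PrimeProducts using (∣∏; ^-∣; prime∤∏)

  prime∤1 : ∀ {p} → Prime p → ¬ + p ∣ 1ℤ
  prime∤1 p-prime p∣1 = prime≢1 p-prime (ℕ.∣1⇒≡1 (∣⇒∣ᵤ p∣1))

  euclidsLemma-ℤ : ∀ {p} → Prime p → ∀ x y → + p ∣ x * y → + p ∣ x ⊎ + p ∣ y
  euclidsLemma-ℤ p-prime x y p∣xy with euclidsLemma (abs x) (abs y) p-prime (subst (_ ℕ.∣_) (abs-* x y) (∣⇒∣ᵤ p∣xy))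
  ... | inj₁ p∣x = inj₁ (∣ᵤ⇒∣ p∣x)
  ... | inj₂ p∣y = inj₂ (∣ᵤ⇒∣ p∣y)

  ∣-flip : ∀ {d} a b → d ∣ a - b → d ∣ b - a
  ∣-flip a b d∣a-b = subst (_ ∣_) (neg-diff a b) (∣m⇒∣-m d∣a-b)
    where
    neg-diff : ∀ a b → - (a - b) ≡ b - a
    neg-diff = solve-∀

  pos-1+* : ∀ a b → + (1 ℕ.+ a ℕ.* b) ≡ 1ℤ + + a * + b
  pos-1+* a b = trans (pos-+ 1 (a ℕ.* b)) (cong (λ z → 1ℤ + z) (pos-* a b))

  bezout-ℕ : ∀ c n → Coprime c n → ∃₂ λ X Y → X * + n + Y * + c ≡ 1ℤ
  bezout-ℕ c n coprime with coprime-Bézout coprime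
  ... | Bézout.+- x y 1+yn≡xc = - + y , + x , (begin
    - + y * + n + + x * + c      ≡⟨ cong (λ z → - + y * + n + z) (trans (sym (pos-* x c)) (cong +_ (sym 1+yn≡xc))) ⟩
    - + y * + n + + (1 ℕ.+ y ℕ.* n) ≡⟨ cong (λ z → - + y * + n + z) (pos-1+* y n) ⟩
    - + y * + n + (1ℤ + + y * + n) ≡⟨ cancel (+ y) (+ n) ⟩
    1ℤ                           ∎)
    where
    open ≡-Reasoning
    cancel : ∀ a b → - a * b + (1ℤ + a * b) ≡ 1ℤ
    cancel = solve-∀
  ... | Bézout.-+ x y 1+xc≡yn = + y , - + x , (begin
    + y * + n + - + x * + c      ≡⟨ cong (_+ - + x * + c) (trans (sym (pos-* y n)) (cong +_ (sym 1+xc≡yn))) ⟩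
    + (1 ℕ.+ x ℕ.* c) + - + x * + c ≡⟨ cong (_+ - + x * + c) (pos-1+* x c) ⟩
    1ℤ + + x * + c + - + x * + c ≡⟨ cancel (+ x) (+ c) ⟩
    1ℤ                           ∎)
    where
    open ≡-Reasoning
    cancel : ∀ a b → 1ℤ + a * b + - a * b ≡ 1ℤ
    cancel = solve-∀

  bezout : ∀ c r → Coprime c (abs r) → ∃₂ λ X Y → X * r + Y * + c ≡ 1ℤ
  bezout c r coprime with bezout-ℕ c (abs r) coprime | +∣i∣≡i⊎+∣i∣≡-i r
  ... | X , Y , eq | inj₁ |r|≡r  = X , Y , subst (λ z → X * z + Y * + c ≡ 1ℤ) |r|≡r eq
  ... | X , Y , eq | inj₂ |r|≡-r = - X , Y , trans (cong (_+ Y * + c) (neg-swap X r)) (subst (λ z → X * z + Y * + c ≡ 1ℤ) |r|≡-r eq)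
    where
    neg-swap : ∀ a b → - a * b ≡ a * - b
    neg-swap = solve-∀

  ExactPower : ℕ → ℕ → ℤ → Set
  ExactPower p e w = + (p ℕ.^ e) ∣ w × ¬ + (p ℕ.^ suc e) ∣ w

  exactPower-− : ∀ {p e} u u′ → ExactPower p e u → + (p ℕ.^ suc e) ∣ u′ → ExactPower p e (u - u′)
  exactPower-− {p} {e} u u′ (p^e∣u , p^[1+e]∤u) p^[1+e]∣u′ =
    ∣m∣n⇒∣m-n p^e∣u (∣-trans (∣ᵤ⇒∣ (ℕ.n∣m*n p)) p^[1+e]∣u′) ,
    λ p^[1+e]∣u-u′ → p^[1+e]∤u (subst (_ ∣_) (diff+ u u′) (∣m∣n⇒∣m+n p^[1+e]∣u-u′ p^[1+e]∣u′))
    where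
    diff+ : ∀ a b → a - b + b ≡ a
    diff+ = solve-∀

  exactPower-flip : ∀ {p e} u u′ → ExactPower p e (u - u′) → ExactPower p e (u′ - u)
  exactPower-flip u u′ (p^e∣ , p^[1+e]∤) = ∣-flip u u′ p^e∣ , λ p^[1+e]∣ → p^[1+e]∤ (∣-flip u′ u p^[1+e]∣)

  -- Write w = r p^e and w′ = r′ p^e with p ∤ r r′; then t = X r′, for X r ≡ 1 modulo p^(N - e), works.
  exactPowers⇒unit-ratio : ∀ {p} → Prime p → ∀ {e N} → e ℕ.< N → ∀ {w w′} → ExactPower p e w → ExactPower p e w′ →
                           ∃ λ t → + (p ℕ.^ N) ∣ t * w - w′ × ¬ + p ∣ t
  exactPowers⇒unit-ratio {p} p-prime {e} {N} e<N {w} {w′} (divides r w≡rpᵉ , p^[1+e]∤w) (divides r′ w′≡r′pᵉ , p^[1+e]∤w′) =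
    X * r′ , divides (- (r′ * Y)) tw-w′≡ , p∤Xr′
    where
    pᵉ = + (p ℕ.^ e)
    k = N ℕ.∸ e
    pᵏ = + (p ℕ.^ k)
    pᴺ≡pᵉpᵏ : + (p ℕ.^ N) ≡ pᵉ * pᵏ
    pᴺ≡pᵉpᵏ = trans (cong (λ z → + (p ℕ.^ z)) (sym (ℕ.m+[n∸m]≡n (ℕ.<⇒≤ e<N)))) (trans (cong +_ (ℕ.^-distribˡ-+-* p e k)) (pos-* (p ℕ.^ e) (p ℕ.^ k)))
    p∤cofactor : ∀ {z r} → z ≡ r * pᵉ → ¬ + (p ℕ.^ suc e) ∣ z → ¬ + p ∣ r
    p∤cofactor {z} {r} z≡rpᵉ p^[1+e]∤z (divides c r≡cp) = p^[1+e]∤z (divides c (begin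
      z             ≡⟨ z≡rpᵉ ⟩
      r * pᵉ        ≡⟨ cong (_* pᵉ) r≡cp ⟩
      c * + p * pᵉ  ≡⟨ *-assoc c (+ p) pᵉ ⟩
      c * (+ p * pᵉ) ≡⟨ cong (c *_) (sym (pos-* p (p ℕ.^ e))) ⟩
      c * + (p ℕ.^ suc e) ∎))
      where open ≡-Reasoning
    p∤r  = p∤cofactor {w} {r} w≡rpᵉ p^[1+e]∤w
    p∤r′ = p∤cofactor {w′} {r′} w′≡r′pᵉ p^[1+e]∤w′
    XY = bezout (p ℕ.^ k) r (prime∤⇒coprime-^ p-prime (λ p∣|r| → p∤r (∣ᵤ⇒∣ p∣|r|)) k)
    X = proj₁ XY
    Y = proj₁ (proj₂ XY)
    Xr+Ypᵏ≡1 : X * r + Y * pᵏ ≡ 1ℤ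
    Xr+Ypᵏ≡1 = proj₂ (proj₂ XY)
    tw-w′≡ : X * r′ * w - w′ ≡ - (r′ * Y) * + (p ℕ.^ N)
    tw-w′≡ = begin
      X * r′ * w - w′                                ≡⟨ cong₂ (λ a b → X * r′ * a - b) w≡rpᵉ w′≡r′pᵉ ⟩
      X * r′ * (r * pᵉ) - r′ * pᵉ                    ≡⟨ cong (λ z → X * r′ * (r * pᵉ) - z) (*-identityʳ (r′ * pᵉ)) ⟨
      X * r′ * (r * pᵉ) - r′ * pᵉ * 1ℤ               ≡⟨ cong (λ z → X * r′ * (r * pᵉ) - r′ * pᵉ * z) Xr+Ypᵏ≡1 ⟨
      X * r′ * (r * pᵉ) - r′ * pᵉ * (X * r + Y * pᵏ) ≡⟨ expand X r r′ pᵉ Y pᵏ ⟩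
      - (r′ * Y) * (pᵉ * pᵏ)                         ≡⟨ cong (- (r′ * Y) *_) (sym pᴺ≡pᵉpᵏ) ⟩
      - (r′ * Y) * + (p ℕ.^ N)                       ∎
      where
      open ≡-Reasoning
      expand : ∀ X r r′ pᵉ Y pᵏ → X * r′ * (r * pᵉ) - r′ * pᵉ * (X * r + Y * pᵏ) ≡ - (r′ * Y) * (pᵉ * pᵏ)
      expand = solve-∀
    p∣pᵏ : + p ∣ pᵏ
    p∣pᵏ = ∣ᵤ⇒∣ (subst (λ z → p ℕ.∣ p ℕ.^ z) (sym (ℕ.+-∸-assoc 1 e<N)) (ℕ.m∣m*n (p ℕ.^ (N ℕ.∸ suc e))))
    p∤Xr′ : ¬ + p ∣ X * r′
    p∤Xr′ p∣Xr′ = [ (λ p∣X → prime∤1 p-prime (subst (_ ∣_) Xr+Ypᵏ≡1 (∣m∣n⇒∣m+n (∣m⇒∣m*n r p∣X) (∣n⇒∣m*n Y p∣pᵏ)))) , p∤r′ ]′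
                    (euclidsLemma-ℤ p-prime X r′ p∣Xr′)

  coprime-∣ℤ-* : ∀ {a b z} → Coprime a b → + a ∣ z → + b ∣ z → + (a ℕ.* b) ∣ z
  coprime-∣ℤ-* {a} {b} {z} coprime a∣z b∣z with ∣⇒∣ᵤ a∣z
  ... | ℕ.divides c |z|≡ca = ∣ᵤ⇒∣ (subst (λ x → a ℕ.* b ℕ.∣ x) (sym |z|≡ca)
          (subst (ℕ._∣ c ℕ.* a) (ℕ.*-comm b a) (ℕ.*-monoˡ-∣ a (coprime-divisor (Coprimality.sym coprime) b∣ca))))
    where
    b∣ca : b ℕ.∣ a ℕ.* c
    b∣ca = subst (b ℕ.∣_) (trans |z|≡ca (ℕ.*-comm c a)) (∣⇒∣ᵤ b∣z)

  opaque
    crt₂ : ∀ {P Q} → Coprime P Q → ∀ t₁ t₂ → ∃ λ t → + P ∣ t - t₁ × + Q ∣ t - t₂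
    crt₂ {P} {Q} coprime t₁ t₂ with bezout-ℕ P Q coprime
    ... | X , Y , XQ+YP≡1 =
      t , subst (_ ∣_) (sym (trans (insert-one t₁) (ring₁ t₁ t₂ X Y (+ P) (+ Q)))) (∣n⇒∣m*n ((t₂ - t₁) * Y) ∣-refl)
        , subst (_ ∣_) (sym (trans (insert-one t₂) (ring₂ t₁ t₂ X Y (+ P) (+ Q)))) (∣n⇒∣m*n ((t₁ - t₂) * X) ∣-refl)
      where
      t : ℤ
      t = t₁ * X * + Q + t₂ * Y * + P
      insert-one : ∀ u → t - u ≡ t - u * (X * + Q + Y * + P)
      insert-one u = cong (λ z → t - z) (trans (sym (*-identityʳ u)) (cong (u *_) (sym XQ+YP≡1)))
      ring₁ : ∀ t₁ t₂ X Y P Q → t₁ * X * Q + t₂ * Y * P - t₁ * (X * Q + Y * P) ≡ (t₂ - t₁) * Y * P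
      ring₁ = solve-∀
      ring₂ : ∀ t₁ t₂ X Y P Q → t₁ * X * Q + t₂ * Y * P - t₂ * (X * Q + Y * P) ≡ (t₁ - t₂) * X * Q
      ring₂ = solve-∀

  ∣-shift : ∀ {d} t t′ w w′ → d ∣ t - t′ → d ∣ t′ * w - w′ → d ∣ t * w - w′
  ∣-shift t t′ w w′ d∣t-t′ d∣t′w-w′ = subst (_ ∣_) (split t t′ w w′) (∣m∣n⇒∣m+n (∣m⇒∣m*n w d∣t-t′) d∣t′w-w′)
    where
    split : ∀ t t′ w w′ → (t - t′) * w + (t′ * w - w′) ≡ t * w - w′
    split = solve-∀

  ∣-unit : ∀ {d} t t′ → d ∣ t - t′ → d ∣ t → d ∣ t′
  ∣-unit t t′ d∣t-t′ d∣t = subst (_ ∣_) (sub-sub t t′) (∣m∣n⇒∣m-n d∣t d∣t-t′)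
    where
    sub-sub : ∀ a b → a - (a - b) ≡ b
    sub-sub = solve-∀

  chinese-remainder : ∀ K (p n : Fin K → ℕ) → (∀ i → Prime (p i)) → Injective _≡_ _≡_ p → (∀ i → 1 ℕ.≤ n i) → ∀ w w′ →
                      (∀ i → ∃ λ t → + (p i ℕ.^ n i) ∣ t * w - w′ × ¬ + p i ∣ t) →
                      ∃ λ t → + (∏ K (λ i → p i ℕ.^ n i)) ∣ t * w - w′ × (∀ i → ¬ + p i ∣ t)
  chinese-remainder zero    p n p-prime p-injective n≥1 w w′ local = 1ℤ , divides (1ℤ * w - w′) (sym (*-identityʳ _)) , λ ()
  chinese-remainder (suc K) p n p-prime p-injective n≥1 w w′ local =
    glue (local Fin.zero) (chinese-remainder K (p ∘ Fin.suc) (n ∘ Fin.suc) (p-prime ∘ Fin.suc) (Fin.suc-injective ∘ p-injective)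
                                               (n≥1 ∘ Fin.suc) w w′ (local ∘ Fin.suc))
    where
    P = p Fin.zero ℕ.^ n Fin.zero
    Q = ∏ K (λ i → p (Fin.suc i) ℕ.^ n (Fin.suc i))
    coprime : Coprime P Q
    coprime = prime∤⇒coprime-^ (p-prime Fin.zero)
      (prime∤∏ (p-prime Fin.zero) K (p ∘ Fin.suc) (n ∘ Fin.suc) (p-prime ∘ Fin.suc) (λ i p₀≡pᵢ₊₁ → Fin.0≢1+n (p-injective p₀≡pᵢ₊₁)))
      (n Fin.zero)
    p∣p^n : ∀ i → + p i ∣ + (p i ℕ.^ n i)
    p∣p^n i = ∣ᵤ⇒∣ (ℕ.∣-trans (ℕ.∣-reflexive (sym (ℕ.^-identityʳ (p i)))) (^-∣ (p i) (n≥1 i)))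
    glue : (∃ λ t → + P ∣ t * w - w′ × ¬ + p Fin.zero ∣ t) → (∃ λ t → + Q ∣ t * w - w′ × (∀ i → ¬ + p (Fin.suc i) ∣ t)) →
           ∃ λ t → + (P ℕ.* Q) ∣ t * w - w′ × (∀ i → ¬ + p i ∣ t)
    glue (t₁ , P∣t₁w-w′ , p₀∤t₁) (t₂ , Q∣t₂w-w′ , pᵢ₊₁∤t₂) with crt₂ coprime t₁ t₂
    ... | t , P∣t-t₁ , Q∣t-t₂ = t , coprime-∣ℤ-* coprime (∣-shift t t₁ w w′ P∣t-t₁ P∣t₁w-w′) (∣-shift t t₂ w w′ Q∣t-t₂ Q∣t₂w-w′) , p∤t
      where
      p∤t : ∀ i → ¬ + p i ∣ t
      p∤t Fin.zero    p₀∣t   = p₀∤t₁ (∣-unit t t₁ (∣-trans (p∣p^n Fin.zero) P∣t-t₁) p₀∣t)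
      p∤t (Fin.suc i) pᵢ₊₁∣t = pᵢ₊₁∤t₂ i (∣-unit t t₂ (∣-trans (∣-trans (p∣p^n (Fin.suc i)) (∣ᵤ⇒∣ (∣∏ K _ i))) Q∣t-t₂) pᵢ₊₁∣t)


module IntegerCongruence (M : ℕ) .⦃ _ : NonZero M ⦄ where

  open import Data.Nat using (_≤_; _∸_; _%_)
  open import Data.Nat.Properties using (≤-total; m∸n+n≡m)
  open import Data.Nat.DivMod using (%-remove-+ˡ)
  open import Data.Nat.Divisibility using (_∣_)
  open import Data.Integer as ℤ using (+_; _-_)
  open import Data.Integer.Properties using (m-n≡m⊖n; ∣m⊖n∣≡∣n⊖m∣; ∣⊖∣-≤; ⊖-≥; pos-+; pos-*)
  open import Data.Integer.Divisibility.Signed using (∣⇒∣ᵤ) renaming (_∣_ to _∣ℤ_)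
  open import Data.Integer.Tactic.RingSolver using (solve-∀)
  open import Data.Sum using (inj₁; inj₂)
  open import Relation.Binary.PropositionalEquality using (trans; cong₂)
  open Residue M

  ∣∸⇒≡ᴹ : ∀ {X Y} → Y ≤ X → M ∣ X ∸ Y → X ≡ᴹ Y
  ∣∸⇒≡ᴹ {X} {Y} Y≤X M∣X∸Y = trans (cong (_% M) (sym (m∸n+n≡m Y≤X))) (%-remove-+ˡ Y M∣X∸Y)

  ∣ℤ⇒≡ᴹ : ∀ {X Y} → + M ∣ℤ + X - + Y → X ≡ᴹ Y
  ∣ℤ⇒≡ᴹ {X} {Y} M∣X-Y with ≤-total Y X
  ... | inj₁ Y≤X = ∣∸⇒≡ᴹ Y≤X (subst (M ∣_) (trans (cong ℤ.∣_∣ (m-n≡m⊖n X Y)) (trans (∣m⊖n∣≡∣n⊖m∣ X Y) (∣⊖∣-≤ Y≤X))) (∣⇒∣ᵤ M∣X-Y))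
  ... | inj₂ X≤Y = sym (∣∸⇒≡ᴹ X≤Y (subst (M ∣_) (trans (cong ℤ.∣_∣ (m-n≡m⊖n X Y)) (∣⊖∣-≤ X≤Y)) (∣⇒∣ᵤ M∣X-Y)))

  ∣-affine⇒≡ᴹ : ∀ t a a′ b b′ → + M ∣ℤ + t ℤ.* (+ a′ - + a) - (+ b′ - + b) → t ℕ.* a′ ℕ.+ b ≡ᴹ t ℕ.* a ℕ.+ b′
  ∣-affine⇒≡ᴹ t a a′ b b′ M∣ = ∣ℤ⇒≡ᴹ (subst (+ M ∣ℤ_) rearrange M∣)
    where
    regroup : ∀ t a a′ b b′ → t ℤ.* (a′ - a) - (b′ - b) ≡ (t ℤ.* a′ ℤ.+ b) - (t ℤ.* a ℤ.+ b′)
    regroup = solve-∀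
    pos-*+ : ∀ a b → + (t ℕ.* a ℕ.+ b) ≡ + t ℤ.* + a ℤ.+ + b
    pos-*+ a b = trans (pos-+ (t ℕ.* a) b) (cong (ℤ._+ + b) (pos-* t a))
    rearrange : + t ℤ.* (+ a′ - + a) - (+ b′ - + b) ≡ + (t ℕ.* a′ ℕ.+ b) - + (t ℕ.* a ℕ.+ b′)
    rearrange = trans (regroup (+ t) (+ a) (+ a′) (+ b) (+ b′)) (sym (cong₂ _-_ (pos-*+ a′ b) (pos-*+ a b′)))

  shifted-difference : ∀ x {a a′} → a ≤ M → a′ ≤ M → + (x ℕ.+ (M ∸ a)) - + (x ℕ.+ (M ∸ a′)) ≡ + a′ - + a
  shifted-difference x {a} {a′} a≤M a′≤M =
    trans (cong₂ _-_ (pos-+∸ a≤M) (pos-+∸ a′≤M)) (cancel (+ x) (+ M) (+ a) (+ a′))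
    where
    pos-∸ : ∀ {b} → b ≤ M → + (M ∸ b) ≡ + M - + b
    pos-∸ {b} b≤M = sym (trans (m-n≡m⊖n M b) (⊖-≥ b≤M))
    pos-+∸ : ∀ {b} → b ≤ M → + (x ℕ.+ (M ∸ b)) ≡ + x ℤ.+ (+ M - + b)
    pos-+∸ {b} b≤M = trans (pos-+ x (M ∸ b)) (cong (λ z → + x ℤ.+ z) (pos-∸ b≤M))
    cancel : ∀ x m a a′ → (x ℤ.+ (m - a)) - (x ℤ.+ (m - a′)) ≡ a′ - a
    cancel = solve-∀


module DivisorPair {K : ℕ} (p n : Fin K → ℕ) (p-prime : ∀ i → Prime (p i)) (p-injective : Injective _≡_ _≡_ p)
                     (α α′ : Fin K → ℕ) (α≤n : ∀ i → α i ℕ.≤ n i) (α′≤n : ∀ i → α′ i ℕ.≤ n i) where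

  open import Defs using (∏; gcdDiff; IsTiling)
  open import Data.Fin using (toℕ)
  open import Data.Fin.Properties using (toℕ<n)
  open import Data.Fin.Subset using (_∈_)
  import Data.Nat.Divisibility as ℕ
  import Data.Nat.Properties as ℕ
  open import Data.Nat.Properties using (<-cmp; <-≤-trans; <⇒≤; m≤n⇒m⊓n≡m; m≥n⇒m⊓n≡n)
  open import Data.Nat.GCD using (gcd)
  open import Data.Nat.Coprimality using (Coprime)
  open import Data.Nat.Primality using (prime⇒nonZero)
  open import Data.Integer using (+_; _+_; _*_; -_; _-_; 1ℤ; _%ℕ_; _/ℕ_)
  open import Data.Integer.Properties using (*-identityˡ; *-zeroˡ; +-inverseʳ)
  open import Data.Integer.DivMod using (a≡a%ℕn+[a/ℕn]*n)
  open import Data.Integer.Divisibility.Signed using (_∣_; divides; ∣ᵤ⇒∣; ∣⇒∣ᵤ; ∣-trans; ∣m∣n⇒∣m-n)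
  open import Data.Integer.Tactic.RingSolver using (solve-∀)
  import Data.Fin.Properties as Fin
  open import Data.Product using (∃; _×_; _,_; proj₁; proj₂)
  open import Data.Sum using (_⊎_; inj₁; inj₂; [_,_]′)
  open import Data.Empty using (⊥; ⊥-elim)
  open import Relation.Nullary using (¬_)
  open import Relation.Nullary.Decidable using (_×-dec_)
  open import Relation.Binary.Definitions using (tri<; tri≈; tri>)
  open import Relation.Binary.PropositionalEquality using (trans; cong₂; module ≡-Reasoning)
  open PrimeProducts
  open IntegerDivisibility

  M m m′ : ℕ
  M  = ∏ K (λ j → p j ℕ.^ n j)
  m  = ∏ K (λ j → p j ℕ.^ α j)
  m′ = ∏ K (λ j → p j ℕ.^ α′ j)

  instance
    M≢0 : NonZero M
    M≢0 = ∏-nonZero K _ (λ i → ℕ.m^n≢0 (p i) (n i) ⦃ prime⇒nonZero (p-prime i) ⦄)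

  exact-difference : ∀ {β β′ u u′} → (∀ i → β′ i ℕ.≤ n i) →
                     gcd u M ≡ ∏ K (λ j → p j ℕ.^ β j) → gcd u′ M ≡ ∏ K (λ j → p j ℕ.^ β′ j) →
                     ∀ i → β i ℕ.< β′ i → ExactPower (p i) (β i) (+ u - + u′)
  exact-difference {β} {β′} {u} {u′} β′≤n gcd[u]≡ gcd[u′]≡ i βᵢ<β′ᵢ = exactPower-− {p i} {β i} (+ u) (+ u′)
    (∣ᵤ⇒∣ (gcd≡∏⇒^∣ K p β u M gcd[u]≡ i) , λ pᵢ^[1+βᵢ]∣u → gcd≡∏⇒^∤ K p n β p-prime p-injective u gcd[u]≡ i (<-≤-trans βᵢ<β′ᵢ (β′≤n i)) (∣⇒∣ᵤ pᵢ^[1+βᵢ]∣u))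
    (∣ᵤ⇒∣ (ℕ.∣-trans (^-∣ (p i) βᵢ<β′ᵢ) (gcd≡∏⇒^∣ K p β′ u′ M gcd[u′]≡ i)))

  exact-difference-≢ : ∀ {u u′} → gcd u M ≡ m → gcd u′ M ≡ m′ → ∀ i → α i ≢ α′ i → ExactPower (p i) (α i ℕ.⊓ α′ i) (+ u - + u′)
  exact-difference-≢ {u} {u′} gcd[u]≡ gcd[u′]≡ i αᵢ≢α′ᵢ with <-cmp (α i) (α′ i)
  ... | tri< αᵢ<α′ᵢ _ _ = subst (λ e → ExactPower (p i) e _) (sym (m≤n⇒m⊓n≡m (<⇒≤ αᵢ<α′ᵢ))) (exact-difference {α} {α′} {u} {u′} α′≤n gcd[u]≡ gcd[u′]≡ i αᵢ<α′ᵢ)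
  ... | tri≈ _ αᵢ≡α′ᵢ _ = ⊥-elim (αᵢ≢α′ᵢ αᵢ≡α′ᵢ)
  ... | tri> _ _ α′ᵢ<αᵢ = subst (λ e → ExactPower (p i) e _) (sym (m≥n⇒m⊓n≡n (<⇒≤ α′ᵢ<αᵢ)))
                                (exactPower-flip {p i} {α′ i} (+ u′) (+ u) (exact-difference {α′} {α} {u′} {u} α≤n gcd[u′]≡ gcd[u]≡ i α′ᵢ<αᵢ))

  ⊓<n : ∀ i → α i ≢ α′ i → α i ℕ.⊓ α′ i ℕ.< n i
  ⊓<n i αᵢ≢α′ᵢ with <-cmp (α i) (α′ i)
  ... | tri< αᵢ<α′ᵢ _ _ = subst (ℕ._< n i) (sym (m≤n⇒m⊓n≡m (<⇒≤ αᵢ<α′ᵢ))) (<-≤-trans αᵢ<α′ᵢ (α′≤n i))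
  ... | tri≈ _ αᵢ≡α′ᵢ _ = ⊥-elim (αᵢ≢α′ᵢ αᵢ≡α′ᵢ)
  ... | tri> _ _ α′ᵢ<αᵢ = subst (ℕ._< n i) (sym (m≥n⇒m⊓n≡n (<⇒≤ α′ᵢ<αᵢ))) (<-≤-trans α′ᵢ<αᵢ (α≤n i))

  module _ {u u′ v v′ : ℕ} (gcd[u]≡ : gcd u M ≡ m) (gcd[u′]≡ : gcd u′ M ≡ m′) (gcd[v]≡ : gcd v M ≡ m) (gcd[v′]≡ : gcd v′ M ≡ m′) where

    local-ratio : ∀ i → α i ≢ α′ i ⊎ (α i ≡ n i × α′ i ≡ n i) →
                  ∃ λ t → + (p i ℕ.^ n i) ∣ t * (+ u - + u′) - (+ v - + v′) × ¬ + p i ∣ t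
    local-ratio i (inj₁ αᵢ≢α′ᵢ) = exactPowers⇒unit-ratio (p-prime i) (⊓<n i αᵢ≢α′ᵢ)
      (exact-difference-≢ {u} {u′} gcd[u]≡ gcd[u′]≡ i αᵢ≢α′ᵢ) (exact-difference-≢ {v} {v′} gcd[v]≡ gcd[v′]≡ i αᵢ≢α′ᵢ)
    local-ratio i (inj₂ (αᵢ≡nᵢ , α′ᵢ≡nᵢ)) =
      1ℤ , subst (_ ∣_) (cong (_- (+ v - + v′)) (sym (*-identityˡ (+ u - + u′))))
             (∣m∣n⇒∣m-n (∣m∣n⇒∣m-n (pᵢ^nᵢ∣ {α} {u} αᵢ≡nᵢ gcd[u]≡) (pᵢ^nᵢ∣ {α′} {u′} α′ᵢ≡nᵢ gcd[u′]≡))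
                         (∣m∣n⇒∣m-n (pᵢ^nᵢ∣ {α} {v} αᵢ≡nᵢ gcd[v]≡) (pᵢ^nᵢ∣ {α′} {v′} α′ᵢ≡nᵢ gcd[v′]≡)))
         , prime∤1 (p-prime i)
      where
      pᵢ^nᵢ∣ : ∀ {β x} → β i ≡ n i → gcd x M ≡ ∏ K (λ j → p j ℕ.^ β j) → + (p i ℕ.^ n i) ∣ + x
      pᵢ^nᵢ∣ {β} {x} βᵢ≡nᵢ gcd[x]≡ = subst (λ e → + (p i ℕ.^ e) ∣ + x) βᵢ≡nᵢ (∣ᵤ⇒∣ (gcd≡∏⇒^∣ K p β x M gcd[x]≡ i))

    M∤v-v′ : ∀ i → α i ≢ α′ i → ¬ + M ∣ + v - + v′
    M∤v-v′ i αᵢ≢α′ᵢ M∣v-v′ with exact-difference-≢ {v} {v′} gcd[v]≡ gcd[v′]≡ i αᵢ≢α′ᵢ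
    ... | _ , pᵢ^[1+e]∤ = pᵢ^[1+e]∤ (∣-trans (∣ᵤ⇒∣ (ℕ.∣-trans (^-∣ (p i) (⊓<n i αᵢ≢α′ᵢ)) (∣∏ K (λ j → p j ℕ.^ n j) i))) M∣v-v′)

  differing-exponent : (¬ m ≡ M ⊎ ¬ m′ ≡ M) → (∀ i → α i ≢ α′ i ⊎ (α i ≡ n i × α′ i ≡ n i)) → ∃ λ i → α i ≢ α′ i
  differing-exponent m≢M shape with Fin.¬∀⟶∃¬ K _ (λ i → (α i ℕ.≟ n i) ×-dec (α′ i ℕ.≟ n i)) ¬all-full
    where
    ¬all-full : ¬ (∀ i → α i ≡ n i × α′ i ≡ n i)
    ¬all-full full = [ (λ m≢M → m≢M (∏-cong K (λ i → cong (p i ℕ.^_) (proj₁ (full i)))))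
                     , (λ m′≢M → m′≢M (∏-cong K (λ i → cong (p i ℕ.^_) (proj₂ (full i))))) ]′ m≢M
  ... | i , ¬full with shape i
  ...   | inj₁ αᵢ≢α′ᵢ = i , αᵢ≢α′ᵢ
  ...   | inj₂ full   = ⊥-elim (¬full full)

  dilation-witness : (∀ i → 1 ℕ.≤ n i) → ∀ {u u′ v v′} → gcd u M ≡ m → gcd u′ M ≡ m′ → gcd v M ≡ m → gcd v′ M ≡ m′ →
                     (∀ i → α i ≢ α′ i ⊎ (α i ≡ n i × α′ i ≡ n i)) →
                     ∃ λ t → Coprime t M × + M ∣ + t * (+ u - + u′) - (+ v - + v′)
  dilation-witness n≥1 {u} {u′} {v} {v′} gcd[u]≡ gcd[u′]≡ gcd[v]≡ gcd[v′]≡ shape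
    with chinese-remainder K p n p-prime p-injective n≥1 _ _ (λ i → local-ratio {u} {u′} {v} {v′} gcd[u]≡ gcd[u′]≡ gcd[v]≡ gcd[v′]≡ i (shape i))
  ... | T , M∣Tw-w′ , p∤T = t , coprime-∏ K p n p-prime p∤t , ∣-shift (+ t) T _ _ M∣t-T M∣Tw-w′
    where
    t = T %ℕ M
    M∣t-T : + M ∣ + t - T
    M∣t-T = divides (- (T /ℕ M)) (begin
      + t - T                             ≡⟨ cong (λ z → + t - z) (a≡a%ℕn+[a/ℕn]*n T M) ⟩
      + t - (+ t + T /ℕ M * + M)          ≡⟨ cancel (+ t) (T /ℕ M) (+ M) ⟩
      - (T /ℕ M) * + M                    ∎)
      where
      open ≡-Reasoning
      cancel : ∀ a q m → a - (a + q * m) ≡ - q * m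
      cancel = solve-∀
    pᵢ∣M : ∀ i → p i ℕ.∣ M
    pᵢ∣M i = ℕ.∣-trans (ℕ.∣-reflexive (sym (ℕ.^-identityʳ (p i)))) (ℕ.∣-trans (^-∣ (p i) (n≥1 i)) (∣∏ K _ i))
    p∤t : ∀ i → ¬ p i ℕ.∣ t
    p∤t i pᵢ∣t = p∤T i (∣-unit (+ t) T (∣-trans (∣ᵤ⇒∣ (pᵢ∣M i)) M∣t-T) (∣ᵤ⇒∣ pᵢ∣t))

  no-matching-pairs : (∀ i → 1 ℕ.≤ n i) → ∀ {A B} → IsTiling M A B → (¬ m ≡ M ⊎ ¬ m′ ≡ M) →
    (∀ i → α i ≢ α′ i ⊎ (α i ≡ n i × α′ i ≡ n i)) → ∀ x y a a′ b b′ → a ∈ A → a′ ∈ A → b ∈ B → b′ ∈ B →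
    gcdDiff M x a ≡ m → gcdDiff M x a′ ≡ m′ → gcdDiff M y b ≡ m → gcdDiff M y b′ ≡ m′ → ⊥
  no-matching-pairs n≥1 tiling m≢M shape x y a a′ b b′ a∈A a′∈A b∈B b′∈B xa≡ xa′≡ yb≡ yb′≡ =
    contradiction (dilation-witness n≥1 {u} {u′} {v} {v′} xa≡ xa′≡ yb≡ yb′≡ shape) (differing-exponent m≢M shape)
    where
    u  = toℕ x ℕ.+ (M ℕ.∸ toℕ a)
    u′ = toℕ x ℕ.+ (M ℕ.∸ toℕ a′)
    v  = toℕ y ℕ.+ (M ℕ.∸ toℕ b)
    v′ = toℕ y ℕ.+ (M ℕ.∸ toℕ b′)
    contradiction : (∃ λ t → Coprime t M × + M ∣ + t * (+ u - + u′) - (+ v - + v′)) → (∃ λ i → α i ≢ α′ i) → ⊥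
    contradiction (t , coprime , M∣tw-w′) (i , αᵢ≢α′ᵢ) = M∤v-v′ {u} {u′} {v} {v′} xa≡ xa′≡ yb≡ yb′≡ i αᵢ≢α′ᵢ M∣v-v′
      where
      open IntegerCongruence M
      w≡ = shifted-difference (toℕ x) (ℕ.<⇒≤ (toℕ<n a)) (ℕ.<⇒≤ (toℕ<n a′))
      w′≡ = shifted-difference (toℕ y) (ℕ.<⇒≤ (toℕ<n b)) (ℕ.<⇒≤ (toℕ<n b′))
      b≡b′ : toℕ b ≡ toℕ b′
      b≡b′ = Tiling.dilation-cancel M tiling t coprime a∈A a′∈A b∈B b′∈B
        (∣-affine⇒≡ᴹ t (toℕ a) (toℕ a′) (toℕ b) (toℕ b′) (subst (+ M ∣_) (cong₂ (λ w w′ → + t * w - w′) w≡ w′≡) M∣tw-w′))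
      M∣v-v′ : + M ∣ + v - + v′
      M∣v-v′ = subst (+ M ∣_) (sym (trans w′≡ (trans (cong (λ z → + z - + toℕ b) (sym b≡b′)) (+-inverseʳ (+ toℕ b)))))
                     (divides (+ 0) (sym (*-zeroˡ (+ M))))


open import Defs
open import Data.Nat using (suc; _≤_; _*_)
open import Data.Nat.Properties using (*-zeroʳ)
open import Data.Fin.Subset using (Subset; _∈_)
open import Data.Product using (_×_; _,_; ∃)
open import Data.Sum using (_⊎_)
open import Data.Empty using (⊥; ⊥-elim)
open import Relation.Nullary using (¬_; yes; no)
open import Relation.Unary using (Decidable)
open import Data.List using ([]; _∷_; length; filter; allFin)

product≡0 : ∀ a b c d → (a ≢ 0 → b ≢ 0 → c ≢ 0 → d ≢ 0 → ⊥) → a * b * c * d ≡ 0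
product≡0 0       b       c       d       _ = refl
product≡0 (suc a) 0       c       d       _ = cong (λ z → z * c * d) (*-zeroʳ (suc a))
product≡0 (suc a) (suc b) 0       d       _ = cong (_* d) (*-zeroʳ (suc a * suc b))
product≡0 (suc a) (suc b) (suc c) 0       _ = *-zeroʳ (suc a * suc b * suc c)
product≡0 (suc a) (suc b) (suc c) (suc d) all≢0⇒⊥ = ⊥-elim (all≢0⇒⊥ (λ ()) (λ ()) (λ ()) (λ ()))

filter-nonempty : ∀ {A : Set} {P : A → Set} (P? : Decidable P) xs → length (filter P? xs) ≢ 0 → ∃ P
filter-nonempty P? []       |filter|≢0 = ⊥-elim (|filter|≢0 refl)
filter-nonempty P? (x ∷ xs) |filter|≢0 with P? x
... | yes Px = x , Px
... | no  _  = filter-nonempty P? xs |filter|≢0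

count≢0⇒∃ : ∀ M X m z → count M X m z ≢ 0 → ∃ λ a → a ∈ X × gcdDiff M z a ≡ m
count≢0⇒∃ M X m z = filter-nonempty _ (allFin M)


mainTheorem14 : (K : ℕ) (p n : Fin K → ℕ) →
    ((i : Fin K) → Prime (p i)) → Injective _≡_ _≡_ p → ((i : Fin K) → 1 ≤ n i) →
    (A B : Subset (primeProd K p n)) → IsTiling (primeProd K p n) A B →
    (α α' : Fin K → ℕ) → ((i : Fin K) → α i ≤ n i) → ((i : Fin K) → α' i ≤ n i) →
    (¬ (primeProd K p α ≡ primeProd K p n) ⊎ ¬ (primeProd K p α' ≡ primeProd K p n)) →
    ((i : Fin K) → (α i ≢ α' i) ⊎ ((α i ≡ n i) × (α' i ≡ n i))) →
    (x y : Fin (primeProd K p n)) →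
    count (primeProd K p n) A (primeProd K p α) x * count (primeProd K p n) A (primeProd K p α') x
      * count (primeProd K p n) B (primeProd K p α) y * count (primeProd K p n) B (primeProd K p α') y
      ≡ 0
mainTheorem14 K p n p-prime p-injective n≥1 A B tiling α α′ α≤n α′≤n m≢M shape x y =
  product≡0 _ _ _ _ λ A[m]≢0 A[m′]≢0 B[m]≢0 B[m′]≢0 →
    let a  , a∈A  , xa≡  = count≢0⇒∃ M A m  x A[m]≢0
        a′ , a′∈A , xa′≡ = count≢0⇒∃ M A m′ x A[m′]≢0
        b  , b∈B  , yb≡  = count≢0⇒∃ M B m  y B[m]≢0
        b′ , b′∈B , yb′≡ = count≢0⇒∃ M B m′ y B[m′]≢0
    in no-matching-pairs n≥1 tiling m≢M shape x y a a′ b b′ a∈A a′∈A b∈B b′∈B xa≡ xa′≡ yb≡ yb′≡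
  where open DivisorPair p n p-prime p-injective α α′ α≤n α′≤n
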